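{- (1) If $q$ is even, then $\mathcal S_1$ consists of Type II points, every line of $T\mathcal S_1$ has Type II, and $\mathcal S_1=\mathrm{Pr}(\mathcal P_{2,q})=\mathrm{Sp}(\mathcal P_{2,q})$. (2) If $q$ is odd, then: (a) $\mathcal S_1$ consists of Type III points, every line of $T\mathcal S_1$ has Type II, and $\mathcal S_1=\mu_{\mathrm{line}}(\Pi_{ -1})=\mathrm{Pr}(\mathcal P_{2,q})=\mathrm{Pr}(\Pi_{ -1})$; (b) $\mathcal S_{ -1}$ consists of Type II points, every line of $T\mathcal S_{ -1}$ has Type III, and $\mathcal S_{ -1}=\mathrm{Sp}(\mu_{\mathrm{pt}}(\Pi_{ -1}))=\mathrm{Sp}(\mathcal P_{2,q})=\mathrm{Sp}(\Pi_{ -1})$.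
   Context: Let $q$ be a prime power, $\mathbb{F}_{q^3}^*=\mathbb{F}_{q^3}\setminus\{0\}$. Points of $\mathrm{PG}(2,q^3)$ have coordinates $(x,y,z)$, lines $[a,b,c]$, incidence iff $ax+by+cz=0$. Let $\phi$ be the collineation $(x,y,z)\mapsto(z^q,x^q,y^q)$ (on lines $[d,e,f]\mapsto[f^q,d^q,e^q]$), with fixed-point subplane $\mathcal P_{2,q}=\{(x,x^q,x^{q^2}):x\in\mathbb{F}_{q^3}^*\}$. A point has Type I, II, III according as its $\phi$-orbit is one point, three collinear points, three non-collinear points; a line has Type I, II, III according as its $\phi$-orbit is one line, three concurrent lines, three non-concurrent lines. $\mu_{\mathrm{pt}}(P)=P^\phi P^{\phi^2}$ for a Type III point $P$, $\mu_{\mathrm{line}}(\ell)=\ell^\phi\cap\ell^{\phi^2}$ for a Type III line $\ell$; for a set of Type III points $\mathcal B$, $\mu_{\mathrm{pt}}(\mathcal B)=\{\mu_{\mathrm{pt}}(P):P\in\mathcal B\}$, and for a subplane $\mathcal B$ with only Type III lines, $\mu_{\mathrm{line}}(\mathcal B)=\{\mu_{\mathrm{line}}(\ell):\ell\text{ a line of }\mathcal B\}$. Let $T=(0,0,1)$, $m_T=[0,0,1]$. For $\theta\in\mathbb{F}_{q^3}^*$: $\mathcal S_\theta=\{(x\theta,x^q,0):x\in\mathbb{F}_{q^3}^*\}$, $T\mathcal S_\theta=\{TX:X\in\mathcal S_\theta\}$, $\Pi_\theta=\{(r\theta^{q+1},r^q,r^{q^2}\theta):r\in\mathbb{F}_{q^3}^*\}$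 (a subplane of order $q$, whose lines are the lines meeting it in $q+1$ points). For a point set $\mathcal B$ not containing $T$, $\mathrm{Pr}(\mathcal B)=\{TP\cap m_T:P\in\mathcal B\}$. For a subplane $\mathcal B$, $\mathrm{Sp}(\mathcal B)=\{\ell\cap m_T:\ell\text{ a line of }\mathcal B\}$, and for a set $L$ of lines other than $m_T$, $\mathrm{Sp}(L)=\{\ell\cap m_T:\ell\in L\}$. -}

module Defs where

open import Data.Nat using (ℕ; zero; suc; _^_; _≥_) renaming (_+_ to _+ℕ_; _*_ to _*ℕ_)
open import Data.Nat.Divisibility using (_∣_)
open import Data.Nat.Primality using (Prime)
open import Data.Fin using (Fin)
open import Data.Product using (Σ; Σ-syntax; _×_; _,_)
open import Relation.Nullary using (¬_)
open import Relation.Binary.PropositionalEquality using (_≡_)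
open import Algebra.Core using (Op₁; Op₂)
open import Algebra.Structures using (IsCommutativeRing)
open import Function.Bundles using (_↔_)

IsPrimePower : ℕ → Set
IsPrimePower q = Σ[ p ∈ ℕ ] Σ[ k ∈ ℕ ] Prime p × k ≥ 1 × q ≡ p ^ k

record FiniteField (q : ℕ) : Set₁ where
  infixl 6 _+_
  infixl 7 _*_
  field
    Carrier : Set
    _+_ _*_ : Op₂ Carrier
    -_      : Op₁ Carrier
    0# 1#   : Carrier
    isCommutativeRing : IsCommutativeRing _≡_ _+_ _*_ -_ 0# 1#
    0≢1     : ¬ (0# ≡ 1#)
    inverse : ∀ x → ¬ (x ≡ 0#) → Σ[ y ∈ Carrier ] x * y ≡ 1#
    card    : Carrier ↔ Fin (q ^ 3)

module PG {q : ℕ} (F : FiniteField q) where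
  open FiniteField F

  pow : Carrier → ℕ → Carrier
  pow x zero    = 1#
  pow x (suc n) = x * pow x n

  fr : Carrier → Carrier
  fr x = pow x q

  fr2 : Carrier → Carrier
  fr2 x = pow x (q ^ 2)

  -- homogeneous coordinate triples (used for both points and lines)
  Triple : Set
  Triple = Carrier × Carrier × Carrier

  NonZero : Triple → Set
  NonZero v = ¬ (v ≡ (0# , 0# , 0#))

  scale : Carrier → Triple → Triple
  scale c (x , y , z) = (c * x , c * y , c * z)

  _∼_ : Triple → Triple → Set
  P ∼ Q = Σ[ c ∈ Carrier ] ¬ (c ≡ 0#) × P ≡ scale c Q

  _I_ : Triple → Triple → Set
  (a , b , c) I (x , y , z) = a * x + b * y + c * z ≡ 0#

  -- the collineation φ: (x,y,z) ↦ (z^q, x^q, y^q); on lines [d,e,f] ↦ [f^q,d^q,e^q]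
  φ : Triple → Triple
  φ (x , y , z) = (fr z , fr x , fr y)

  Collinear : Triple → Triple → Triple → Set
  Collinear P Q R = Σ[ ℓ ∈ Triple ] NonZero ℓ × ℓ I P × ℓ I Q × ℓ I R

  Concurrent : Triple → Triple → Triple → Set
  Concurrent l m n = Σ[ P ∈ Triple ] NonZero P × l I P × m I P × n I P

  -- Types of points (P a nonzero triple); φ³ = id, so orbits have size 1 or 3
  TypeIPt TypeIIPt TypeIIIPt : Triple → Set
  TypeIPt P   = φ P ∼ P
  TypeIIPt P  = ¬ TypeIPt P × Collinear P (φ P) (φ (φ P))
  TypeIIIPt P = ¬ Collinear P (φ P) (φ (φ P))

  TypeILine TypeIILine TypeIIILine : Triple → Set
  TypeILine ℓ   = φ ℓ ∼ ℓ
  TypeIILine ℓ  = ¬ TypeILine ℓ × Concurrent ℓ (φ ℓ) (φ (φ ℓ))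
  TypeIIILine ℓ = ¬ Concurrent ℓ (φ ℓ) (φ (φ ℓ))

  TripleSet : Set₁
  TripleSet = Triple → Set

  _≐_ : TripleSet → TripleSet → Set
  A ≐ B = ∀ P → (A P → B P) × (B P → A P)

  T : Triple
  T = (0# , 0# , 1#)

  mT : Triple
  mT = (0# , 0# , 1#)

  S : Carrier → TripleSet
  S θ P = Σ[ x ∈ Carrier ] ¬ (x ≡ 0#) × P ∼ (x * θ , fr x , 0#)

  TS : Carrier → TripleSet
  TS θ ℓ = NonZero ℓ × Σ[ X ∈ Triple ] S θ X × ℓ I T × ℓ I X

  P2q : TripleSet
  P2q P = Σ[ x ∈ Carrier ] ¬ (x ≡ 0#) × P ∼ (x , fr x , fr2 x)

  Π : Carrier → TripleSet
  Π θ P = Σ[ r ∈ Carrier ] ¬ (r ≡ 0#) × P ∼ (r * pow θ (q +ℕ 1) , fr r , fr2 r * θ)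

  -- lines of a subplane B (of order q): lines meeting B in exactly q+1 points
  LineOf : TripleSet → TripleSet
  LineOf B ℓ = NonZero ℓ ×
    Σ[ f ∈ (Fin (suc q) → Triple) ]
      (∀ i → B (f i) × ℓ I f i) ×
      (∀ i j → f i ∼ f j → i ≡ j) ×
      (∀ P → B P → ℓ I P → Σ[ i ∈ Fin (suc q) ] P ∼ f i)

  -- Pr(B) = {TP ∩ m_T : P ∈ B}
  Pr : TripleSet → TripleSet
  Pr B R = NonZero R × mT I R ×
    Σ[ P ∈ Triple ] B P × Σ[ ℓ ∈ Triple ] NonZero ℓ × ℓ I T × ℓ I P × ℓ I R

  -- Sp(L) = {ℓ ∩ m_T : ℓ ∈ L} for a set L of lines other than m_T
  SpL : TripleSet → TripleSet
  SpL L R = NonZero R × mT I R × Σ[ ℓ ∈ Triple ] L ℓ × ¬ (ℓ ∼ mT) × ℓ I R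

  Sp : TripleSet → TripleSet
  Sp B = SpL (LineOf B)

  -- μ_line(B) = {ℓ^φ ∩ ℓ^{φ²} : ℓ a line of B}
  μline : TripleSet → TripleSet
  μline B R = NonZero R × Σ[ ℓ ∈ Triple ] LineOf B ℓ × φ ℓ I R × φ (φ ℓ) I R

  -- μ_pt(B) = {P^φ P^{φ²} : P ∈ B}  (a set of lines)
  μpt : TripleSet → TripleSet
  μpt B ℓ = NonZero ℓ × Σ[ P ∈ Triple ] B P × ℓ I φ P × ℓ I φ (φ P)

  Part1 : Set
  Part1 = (∀ P → S 1# P → TypeIIPt P)
        × (∀ ℓ → TS 1# ℓ → TypeIILine ℓ)
        × (S 1# ≐ Pr P2q)
        × (S 1# ≐ Sp P2q)

  Part2a : Set
  Part2a = (∀ P → S 1# P → TypeIIIPt P)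
         × (∀ ℓ → TS 1# ℓ → TypeIILine ℓ)
         × (S 1# ≐ μline (Π (- 1#)))
         × (S 1# ≐ Pr P2q)
         × (S 1# ≐ Pr (Π (- 1#)))

  Part2b : Set
  Part2b = (∀ P → S (- 1#) P → TypeIIPt P)
         × (∀ ℓ → TS (- 1#) ℓ → TypeIIILine ℓ)
         × (S (- 1#) ≐ SpL (μpt (Π (- 1#))))
         × (S (- 1#) ≐ Sp P2q)
         × (S (- 1#) ≐ Sp (Π (- 1#)))

{-# OPTIONS --safe #-}
-- Write x^q for the Frobenius map and Tr x = x + x^q + x^{q²}.  Counting the roots of X^q - X and
-- of X^{q²} + X^q + X shows that F_q has q elements and that the traceless elements form a plane W
-- over F_q.  Hence the lines of P_{2,q} are the lines [a, a^q, a^{q²}] with a ≠ 0 (their q + 1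
-- points are a⁻¹ W modulo F_q), and reflecting z ↦ -z gives the lines of Π_{-1}.
-- For θ ∈ F_q the point (xθ, x^q, 0) of S_θ is collinear with its φ-images iff θ³ = -1, and the
-- line joining it to T has the coordinates of a point of S_{-θ}; as φ acts on points and lines by the
-- same formula, this settles all types.  The set equalities are then computations with the point
-- (b, -a, 0) in which a line [a, b, c] meets m_T.
module Submission where

open import Defs
open import Data.Nat as ℕ using (ℕ; zero; suc; _!; _≤_; _<_; z≤n; s≤s)
import Data.Nat.Properties as ℕ
open import Data.Nat.Divisibility using (_∣_; divides; ∣-trans; ∣⇒≤; ∣1⇒≡1; m∣m*n; m%n≡0⇒n∣m)
open import Data.Nat.DivMod using (_%_; _/_; m*[n/m]≡n; m≡m%n+[m/n]*n; m%n<n)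
open import Data.Nat.Primality using (Prime; prime?; euclidsLemma; prime⇒nonZero; prime⇒nonTrivial; prime⇒irreducible)
open import Data.Nat.Combinatorics using (_C_; k![n∸k]!∣n!; nCn≡1)
open import Data.Nat.Combinatorics.Specification using (nCk≡n!/k![n-k]!)
open import Data.Integer as ℤ using (ℤ; -[1+_]; 0ℤ; 1ℤ)
import Data.Integer.Properties as ℤ
open import Data.Sign as Sign using (Sign)
open import Data.Fin as Fin using (Fin; toℕ; fromℕ; inject₁; punchIn)
import Data.Fin.Properties as Fin
open import Data.Fin.Permutation using (Permutation; _⟨$⟩ʳ_)
open import Data.Maybe using (Maybe; just; nothing)
open import Data.Product using (Σ; Σ-syntax; _×_; _,_; proj₁; proj₂)
open import Data.Sum using (_⊎_; inj₁; inj₂)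
open import Data.List using (List; []; _∷_; _++_; length; filter; map; tabulate; lookup; cartesianProductWith; allFin)
open import Data.List.Properties using (length-++; length-map; length-tabulate)
open import Data.List.Relation.Unary.All as All using (All; []; _∷_)
import Data.List.Relation.Unary.All.Properties as All
open import Data.List.Relation.Unary.Any as Any using (here; there)
import Data.List.Relation.Unary.Any.Properties as Any
open import Data.List.Relation.Unary.AllPairs using ([]; _∷_)
open import Data.List.Relation.Unary.Unique.Propositional using (Unique)
import Data.List.Relation.Unary.Unique.Propositional.Properties as Unique
open import Data.List.Membership.Propositional using (_∈_; _∉_; find)
open import Data.List.Membership.Propositional.Properties
  using (∈-lookup; ∈-filter⁺; ∈-filter⁻; ∈-tabulate⁺; ∈-map⁺; ∈-cartesianProductWith⁻)
open import Relation.Nullary using (¬_; Dec; yes; no; ¬?; contradiction)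
open import Relation.Nullary.Decidable using (via-injection; from-yes)
open import Relation.Binary.Definitions using (DecidableEquality)
open import Relation.Binary.PropositionalEquality as ≡
  using (_≡_; _≢_; refl; sym; trans; cong; cong₂; subst; subst₂; module ≡-Reasoning)
open import Function using (id; _∘_; Inverse; _↔_; mk↔ₛ′)
open import Function.Properties.Inverse using (↔-sym; ↔-trans; ↔⇒↣)
open import Algebra.Bundles using (CommutativeRing; CommutativeMonoid)
import Algebra.Solver.Ring.AlmostCommutativeRing as ACR
import Algebra.Solver.Ring
import Algebra.Properties.Ring
import Algebra.Properties.CommutativeMonoid.Sum as CommutativeMonoidSum
import Algebra.Properties.Semiring.Mult
import Algebra.Properties.Semiring.Exp
import Algebra.Properties.CommutativeSemiring.Exp

module IntegerSolver {c ℓ} (R : CommutativeRing c ℓ) where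
  open CommutativeRing R renaming (refl to ≈-refl; sym to ≈-sym; trans to ≈-trans)
  open import Algebra.Properties.Ring ring
  open import Algebra.Properties.Semiring.Mult.TCOptimised semiring using (1+×; ×-homo-+; ×1-homo-*) renaming (_×_ to _·_)
  open import Relation.Binary.Reasoning.Setoid setoid

  -- With the optimised multiple, ι 0ℤ and ι 1ℤ are 0# and 1# on the nose, so `con 0ℤ` and
  -- `con 1ℤ` can stand for 0# and 1# in solver calls.
  ι : ℤ → Carrier
  ι (ℤ.+ n)  = n · 1#
  ι -[1+ n ] = - (suc n · 1#)

  ι-⊖ : ∀ m n → ι (m ℤ.⊖ n) ≈ m · 1# - n · 1#
  ι-⊖ m       zero    = ≈-sym (≈-trans (+-congˡ -0#≈0#) (+-identityʳ _))
  ι-⊖ zero    (suc n) = ≈-sym (+-identityˡ _)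
  ι-⊖ (suc m) (suc n) = begin
    ι (suc m ℤ.⊖ suc n)                         ≡⟨ ≡.cong ι (ℤ.[1+m]⊖[1+n]≡m⊖n m n) ⟩
    ι (m ℤ.⊖ n)                                 ≈⟨ ι-⊖ m n ⟩
    m · 1# - n · 1#                             ≈⟨ +-congʳ (+-identityˡ _) ⟨
    (0# + m · 1#) - n · 1#                      ≈⟨ +-congʳ (+-congʳ (-‿inverseʳ 1#)) ⟨
    ((1# - 1#) + m · 1#) - n · 1#               ≈⟨ +-congʳ (+-assoc 1# (- 1#) _) ⟩
    (1# + (- 1# + m · 1#)) - n · 1#             ≈⟨ +-congʳ (+-congˡ (+-comm (- 1#) _)) ⟩
    (1# + (m · 1# - 1#)) - n · 1#               ≈⟨ +-congʳ (+-assoc 1# _ (- 1#)) ⟨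
    ((1# + m · 1#) - 1#) - n · 1#               ≈⟨ +-assoc _ (- 1#) _ ⟩
    (1# + m · 1#) + (- 1# - n · 1#)             ≈⟨ +-congˡ (-‿+-comm 1# _) ⟩
    (1# + m · 1#) - (1# + n · 1#)               ≈⟨ +-cong (1+× m 1#) (-‿cong (1+× n 1#)) ⟨
    suc m · 1# - suc n · 1#                     ∎

  ι-+ : ∀ i j → ι (i ℤ.+ j) ≈ ι i + ι j
  ι-+ (ℤ.+ m)  (ℤ.+ n)  = ×-homo-+ 1# m n
  ι-+ (ℤ.+ m)  -[1+ n ] = ι-⊖ m (suc n)
  ι-+ -[1+ m ] (ℤ.+ n)  = ≈-trans (ι-⊖ n (suc m)) (+-comm _ _)
  ι-+ -[1+ m ] -[1+ n ] = begin
    - (suc (suc (m ℕ.+ n)) · 1#)       ≡⟨ ≡.cong (λ k → - (suc k · 1#)) (ℕ.+-suc m n) ⟨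
    - ((suc m ℕ.+ suc n) · 1#)         ≈⟨ -‿cong (×-homo-+ 1# (suc m) (suc n)) ⟩
    - (suc m · 1# + suc n · 1#)        ≈⟨ -‿+-comm _ _ ⟨
    - (suc m · 1#) - (suc n · 1#)      ∎

  ι-neg : ∀ i → ι (ℤ.- i) ≈ - ι i
  ι-neg (ℤ.+ zero)    = ≈-sym -0#≈0#
  ι-neg (ℤ.+ suc n)   = ≈-refl
  ι-neg -[1+ n ]      = ≈-sym (-‿involutive _)

  ι-◃⁺ : ∀ n → ι (Sign.+ ℤ.◃ n) ≈ n · 1#
  ι-◃⁺ zero    = ≈-refl
  ι-◃⁺ (suc n) = ≈-refl

  ι-◃⁻ : ∀ n → ι (Sign.- ℤ.◃ n) ≈ - (n · 1#)
  ι-◃⁻ zero    = ≈-sym -0#≈0#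
  ι-◃⁻ (suc n) = ≈-refl

  ι-* : ∀ i j → ι (i ℤ.* j) ≈ ι i * ι j
  ι-* (ℤ.+ m)  (ℤ.+ n)  = ≈-trans (ι-◃⁺ (m ℕ.* n)) (×1-homo-* m n)
  ι-* (ℤ.+ m)  -[1+ n ] = begin
    ι (Sign.- ℤ.◃ m ℕ.* suc n)          ≈⟨ ι-◃⁻ (m ℕ.* suc n) ⟩
    - ((m ℕ.* suc n) · 1#)              ≈⟨ -‿cong (×1-homo-* m (suc n)) ⟩
    - (m · 1# * suc n · 1#)             ≈⟨ -‿distribʳ-* _ _ ⟩
    m · 1# * - (suc n · 1#)             ∎
  ι-* -[1+ m ] (ℤ.+ n)  = begin
    ι (Sign.- ℤ.◃ suc m ℕ.* n)          ≈⟨ ι-◃⁻ (suc m ℕ.* n) ⟩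
    - ((suc m ℕ.* n) · 1#)              ≈⟨ -‿cong (×1-homo-* (suc m) n) ⟩
    - (suc m · 1# * n · 1#)             ≈⟨ -‿distribˡ-* _ _ ⟩
    - (suc m · 1#) * n · 1#             ∎
  ι-* -[1+ m ] -[1+ n ] = begin
    (suc m ℕ.* suc n) · 1#              ≈⟨ ×1-homo-* (suc m) (suc n) ⟩
    suc m · 1# * suc n · 1#             ≈⟨ -‿involutive _ ⟨
    - - (suc m · 1# * suc n · 1#)       ≈⟨ -‿cong (-‿distribʳ-* _ _) ⟩
    - (suc m · 1# * - (suc n · 1#))     ≈⟨ -‿distribˡ-* _ _ ⟩
    - (suc m · 1#) * - (suc n · 1#)     ∎

  morphism : ℤ.+-*-rawRing ACR.-Raw-AlmostCommutative⟶ ACR.fromCommutativeRing R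
  morphism = record
    { ⟦_⟧ = ι ; +-homo = ι-+ ; *-homo = ι-* ; -‿homo = ι-neg ; 0-homo = ≈-refl ; 1-homo = ≈-refl }

  ι-≟ : ∀ i j → Maybe (ι i ≈ ι j)
  ι-≟ i j with i ℤ.≟ j
  ... | yes ≡.refl = just ≈-refl
  ... | no _     = nothing

  open Algebra.Solver.Ring ℤ.+-*-rawRing (ACR.fromCommutativeRing R) morphism ι-≟ public
    using (solve; _:=_; _:+_; _:*_; _:-_; :-_; con)

prime∤m! : ∀ {p m} → Prime p → m ℕ.< p → ¬ p ∣ m !
prime∤m! {p} {zero}  p-prime _   p∣1 = ℕ.>⇒≢ (ℕ.nonTrivial⇒n>1 p {{prime⇒nonTrivial p-prime}}) (∣1⇒≡1 p∣1)
prime∤m! {p} {suc m} p-prime m<p p∣m! with euclidsLemma (suc m) (m !) p-prime p∣m!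
... | inj₁ p∣1+m = ℕ.<⇒≱ m<p (∣⇒≤ p∣1+m)
... | inj₂ p∣m!  = prime∤m! p-prime (ℕ.<-trans (ℕ.n<1+n m) m<p) p∣m!

prime∣pCk : ∀ {p k} → Prime p → 0 ℕ.< k → k ℕ.< p → p ∣ p C k
prime∣pCk {p} {k} p-prime 0<k k<p
  with euclidsLemma (k ! ℕ.* (p ℕ.∸ k) !) (p C k) p-prime p∣k![p-k]!pCk
  where
  instance _ = k ℕ.!* (p ℕ.∸ k) !≢0
  p∣k![p-k]!pCk : p ∣ (k ! ℕ.* (p ℕ.∸ k) !) ℕ.* (p C k)
  p∣k![p-k]!pCk = ≡.subst (p ∣_) k![p-k]!pCk≡p! (p∣p! p {{prime⇒nonZero p-prime}})
    where
    p∣p! : ∀ n → .{{ℕ.NonZero n}} → n ∣ n !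
    p∣p! (suc n) = m∣m*n (n !)
    k![p-k]!pCk≡p! : p ! ≡ (k ! ℕ.* (p ℕ.∸ k) !) ℕ.* (p C k)
    k![p-k]!pCk≡p! = ≡.sym (≡.trans (≡.cong ((k ! ℕ.* (p ℕ.∸ k) !) ℕ.*_) (nCk≡n!/k![n-k]! (ℕ.<⇒≤ k<p)))
                                    (m*[n/m]≡n (k![n∸k]!∣n! (ℕ.<⇒≤ k<p))))
... | inj₂ p∣pCk = p∣pCk
... | inj₁ p∣k![p-k]! with euclidsLemma (k !) ((p ℕ.∸ k) !) p-prime p∣k![p-k]!
...   | inj₁ p∣k!     = contradiction p∣k! (prime∤m! p-prime k<p)
...   | inj₂ p∣[p-k]! = contradiction p∣[p-k]! (prime∤m! p-prime (ℕ.∸-monoʳ-< {p} {k} {0} 0<k (ℕ.<⇒≤ k<p)))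

module Frobenius {c ℓ} (R : CommutativeRing c ℓ) where
  open CommutativeRing R renaming (refl to ≈-refl; sym to ≈-sym; trans to ≈-trans)
  open Algebra.Properties.Semiring.Mult semiring using (×-assoc-*; ×-assocˡ; ×-congʳ) renaming (_×_ to _·_)
  open Algebra.Properties.Semiring.Exp semiring using (_^_; ^-assocʳ; ^-congˡ)
  open import Algebra.Properties.Monoid.Sum +-monoid using (sum; sum-init-last; sum-cong-≋; sum-replicate-zero)
  open import Algebra.Properties.CommutativeSemiring.Binomial commutativeSemiring using (theorem; binomialTerm)
  open import Relation.Binary.Reasoning.Setoid setoid

  module _ {p} (p-prime : Prime p) (p·1≈0 : p · 1# ≈ 0#) where

    p·≈0 : ∀ z → p · z ≈ 0#
    p·≈0 z = begin
      p · z            ≈⟨ ×-congʳ p (*-identityˡ z) ⟨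
      p · (1# * z)     ≈⟨ ×-assoc-* p 1# z ⟨
      (p · 1#) * z     ≈⟨ *-congʳ p·1≈0 ⟩
      0# * z           ≈⟨ zeroˡ z ⟩
      0#               ∎

    p∣n⇒n·≈0 : ∀ {n} → p ∣ n → ∀ z → n · z ≈ 0#
    p∣n⇒n·≈0 (divides d ≡.refl) z = begin
      (d ℕ.* p) · z    ≡⟨ ≡.cong (_· z) (ℕ.*-comm d p) ⟩
      (p ℕ.* d) · z    ≈⟨ ×-assocˡ z p d ⟨
      p · (d · z)      ≈⟨ p·≈0 (d · z) ⟩
      0#               ∎

    ^p-homo-+ : ∀ x y → (x + y) ^ p ≈ x ^ p + y ^ p
    ^p-homo-+ x y = frobenius (ℕ.pred p) (≡.sym (ℕ.suc-pred p {{prime⇒nonZero p-prime}}))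
      where
      term : ∀ m → Fin (suc (suc m)) → Carrier
      term m = binomialTerm x y (suc m)
      frobenius : ∀ m → p ≡ suc m → (x + y) ^ p ≈ x ^ p + y ^ p
      frobenius m ≡.refl = begin
        (x + y) ^ suc m                                              ≈⟨ theorem (suc m) x y ⟩
        term m Fin.zero + sum (λ i → term m (Fin.suc i))              ≈⟨ +-cong first (sum-init-last (λ i → term m (Fin.suc i))) ⟩
        y ^ suc m + (sum (λ i → term m (Fin.suc (inject₁ i))) + term m (Fin.suc (fromℕ m)))
                                                                     ≈⟨ +-congˡ (+-cong middle last) ⟩
        y ^ suc m + (0# + x ^ suc m)                                  ≈⟨ +-congˡ (+-identityˡ _) ⟩
        y ^ suc m + x ^ suc m                                         ≈⟨ +-comm _ _ ⟩
        x ^ suc m + y ^ suc m                                         ∎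
        where
        first : term m Fin.zero ≈ y ^ suc m
        first = ≈-trans (+-identityʳ _) (*-identityˡ _)
        middle : sum (λ i → term m (Fin.suc (inject₁ i))) ≈ 0#
        middle = ≈-trans (sum-cong-≋ (λ i → p∣n⇒n·≈0 (prime∣pCk p-prime (ℕ.s≤s ℕ.z≤n) (ℕ.s≤s (toℕ<m i))) _))
                       (sum-replicate-zero m)
          where
          toℕ<m : ∀ i → toℕ (inject₁ i) ℕ.< m
          toℕ<m i = ≡.subst (ℕ._< m) (≡.sym (Fin.toℕ-inject₁ i)) (Fin.toℕ<n i)
        last : term m (Fin.suc (fromℕ m)) ≈ x ^ suc m
        last = begin
          (suc m C suc t) · (x ^ suc t * y ^ (m ℕ.∸ t))   ≡⟨ ≡.cong (λ k → (suc m C suc k) · (x ^ suc k * y ^ (m ℕ.∸ k))) (Fin.toℕ-fromℕ m) ⟩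
          (suc m C suc m) · (x ^ suc m * y ^ (m ℕ.∸ m))   ≡⟨ ≡.cong₂ (λ c e → c · (x ^ suc m * y ^ e)) (nCn≡1 (suc m)) (ℕ.n∸n≡0 m) ⟩
          x ^ suc m * 1# + 0#                             ≈⟨ ≈-trans (+-identityʳ _) (*-identityʳ _) ⟩
          x ^ suc m                                       ∎
          where t = toℕ (fromℕ m)

    ^p^j-homo-+ : ∀ j x y → (x + y) ^ (p ℕ.^ j) ≈ x ^ (p ℕ.^ j) + y ^ (p ℕ.^ j)
    ^p^j-homo-+ zero    x y = distribʳ 1# x y
    ^p^j-homo-+ (suc j) x y = begin
      (x + y) ^ (p ℕ.* p ℕ.^ j)                       ≈⟨ ^-assocʳ (x + y) p (p ℕ.^ j) ⟨
      ((x + y) ^ p) ^ (p ℕ.^ j)                       ≈⟨ ^-congˡ (p ℕ.^ j) (^p-homo-+ x y) ⟩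
      (x ^ p + y ^ p) ^ (p ℕ.^ j)                     ≈⟨ ^p^j-homo-+ j (x ^ p) (y ^ p) ⟩
      (x ^ p) ^ (p ℕ.^ j) + (y ^ p) ^ (p ℕ.^ j)       ≈⟨ +-cong (^-assocʳ x p _) (^-assocʳ y p _) ⟩
      x ^ (p ℕ.* p ℕ.^ j) + y ^ (p ℕ.* p ℕ.^ j)       ∎

module ImageCounting {A B : Set} (_≟_ : DecidableEquality B) (f : A → B) (m : ℕ)
  (fibre-bound : ∀ t {Y} → Unique Y → All (λ y → f y ≡ t) Y → length Y ≤ m)
  where

  private
    length-split : ∀ t xs → length xs ≡ length (filter (λ x → f x ≟ t) xs) ℕ.+ length (filter (λ x → ¬? (f x ≟ t)) xs)
    length-split t []       = refl
    length-split t (x ∷ xs) with f x ≟ t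
    ... | yes _ = cong suc (length-split t xs)
    ... | no _  = trans (cong suc (length-split t xs)) (sym (ℕ.+-suc _ _))

    ∈-tail : ∀ {t y : B} {I} → y ∈ t ∷ I → y ≢ t → y ∈ I
    ∈-tail (here y≡t) y≢t = contradiction y≡t y≢t
    ∈-tail (there y∈I) _  = y∈I

  image-bound : ∀ (I : List B) {X} → Unique X → All (λ x → f x ∈ I) X → length X ≤ m ℕ.* length I
  image-bound []      {[]}    _ _        = z≤n
  image-bound []      {_ ∷ _} _ (() ∷ _)
  image-bound (t ∷ I) {X}     X! fX∈t∷I  = begin
    length X                                  ≡⟨ length-split t X ⟩
    length over-t ℕ.+ length elsewhere        ≤⟨ ℕ.+-mono-≤ (fibre-bound t (Unique.filter⁺ _ X!) (All.all-filter _ X))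
                                                             (image-bound I (Unique.filter⁺ _ X!) elsewhere∈I) ⟩
    m ℕ.+ m ℕ.* length I                      ≡⟨ ℕ.*-suc m (length I) ⟨
    m ℕ.* length (t ∷ I)                      ∎
    where
    open ℕ.≤-Reasoning
    over-t = filter (λ x → f x ≟ t) X
    elsewhere = filter (λ x → ¬? (f x ≟ t)) X
    elsewhere∈I : All (λ x → f x ∈ I) elsewhere
    elsewhere∈I = All.zipWith (λ (fx∈t∷I , fx≢t) → ∈-tail fx∈t∷I fx≢t)
                              (All.filter⁺ _ fX∈t∷I , All.all-filter _ X)

module ListCounting {A : Set} (_≟_ : DecidableEquality A) where
  open import Data.List.Membership.DecPropositional _≟_ using (_∈?_)

  subset-bound : ∀ I {X} → Unique X → All (_∈ I) X → length X ≤ length I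
  subset-bound I {X} X! X⊆I = subst (length X ≤_) (ℕ.*-identityˡ (length I)) (image-bound I X! X⊆I)
    where
    at-most-one : ∀ t {Y} → Unique Y → All (_≡ t) Y → length Y ≤ 1
    at-most-one t {[]}        _                 _                  = z≤n
    at-most-one t {_ ∷ []}    _                 _                  = s≤s z≤n
    at-most-one t {_ ∷ _ ∷ _} ((y≢y′ ∷ _) ∷ _) (y≡t ∷ y′≡t ∷ _) = contradiction (trans y≡t (sym y′≡t)) y≢y′
    open ImageCounting _≟_ (λ x → x) 1 at-most-one

  ∃-∉ : ∀ I {X} → Unique X → length I < length X → Σ[ x ∈ A ] x ∈ X × x ∉ I
  ∃-∉ I {X} X! |I|<|X| with All.all? (_∈? I) X
  ... | yes X⊆I = contradiction (subset-bound I X! X⊆I) (ℕ.<⇒≱ |I|<|X|)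
  ... | no X⊈I  = find (All.¬All⇒Any¬ (_∈? I) X X⊈I)

lookup-injective : ∀ {A : Set} {xs : List A} → Unique xs → ∀ i j → lookup xs i ≡ lookup xs j → i ≡ j
lookup-injective {xs = _ ∷ _} _            Fin.zero    Fin.zero    _  = refl
lookup-injective {xs = _ ∷ _} (x∉xs ∷ _)   Fin.zero    (Fin.suc j) eq = contradiction eq (All.lookup x∉xs (∈-lookup j))
lookup-injective {xs = _ ∷ _} (x∉xs ∷ _)   (Fin.suc i) Fin.zero    eq = contradiction (sym eq) (All.lookup x∉xs (∈-lookup i))
lookup-injective {xs = _ ∷ _} (_ ∷ xs!)    (Fin.suc i) (Fin.suc j) eq = cong Fin.suc (lookup-injective xs! i j eq)

length-cartesianProductWith : ∀ {A B C : Set} (f : A → B → C) xs ys →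
                              length (cartesianProductWith f xs ys) ≡ length xs ℕ.* length ys
length-cartesianProductWith f []       ys = refl
length-cartesianProductWith f (x ∷ xs) ys = begin
  length (map (f x) ys ++ cartesianProductWith f xs ys)           ≡⟨ length-++ (map (f x) ys) ⟩
  length (map (f x) ys) ℕ.+ length (cartesianProductWith f xs ys) ≡⟨ cong₂ ℕ._+_ (length-map (f x) ys) (length-cartesianProductWith f xs ys) ⟩
  length ys ℕ.+ length xs ℕ.* length ys                           ∎
  where open ≡-Reasoning

1+n≤n² : ∀ {n} → 2 ≤ n → suc n ≤ n ℕ.^ 2
1+n≤n² {n} 2≤n = begin
  suc n            ≤⟨ ℕ.+-monoˡ-≤ n (ℕ.≤-trans (s≤s z≤n) 2≤n) ⟩
  n ℕ.+ n          ≡⟨ cong (n ℕ.+_) (ℕ.+-identityʳ n) ⟨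
  2 ℕ.* n          ≤⟨ ℕ.*-monoˡ-≤ n 2≤n ⟩
  n ℕ.* n          ≡⟨ cong (n ℕ.*_) (ℕ.*-identityʳ n) ⟨
  n ℕ.^ 2          ∎
  where open ℕ.≤-Reasoning

module EnumeratedSum {a ℓ} (M : CommutativeMonoid a ℓ) {X : Set} {n} (enum : X ↔ Fin n) where
  open CommutativeMonoid M
    using (_≈_; _∙_; ∙-cong; ∙-congˡ; ∙-congʳ; setoid; commutativeSemigroup)
    renaming (Carrier to A; reflexive to ≈-reflexive; trans to ≈-trans)
  open CommutativeMonoidSum M using (sum-permute; sum-cong-≗; sum-remove)
  open CommutativeMonoidSum M using (sum) public
  open import Algebra.Properties.CommutativeSemigroup commutativeSemigroup using (x∙yz≈y∙xz)
  open import Relation.Binary.Reasoning.Setoid setoid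

  elem : Fin n → X
  elem = Inverse.from enum

  ∑ : (X → A) → A
  ∑ g = sum (g ∘ elem)

  ∑-reindex : (g : X → A) (σ σ⁻¹ : X → X) → (∀ x → σ (σ⁻¹ x) ≡ x) → (∀ x → σ⁻¹ (σ x) ≡ x) →
              ∑ g ≈ ∑ (g ∘ σ)
  ∑-reindex g σ σ⁻¹ σσ⁻¹ σ⁻¹σ =
    ≈-trans (sum-permute (g ∘ elem) π) (≈-reflexive (sum-cong-≗ {n} {g ∘ elem ∘ (π ⟨$⟩ʳ_)} {g ∘ σ ∘ elem} σ-elem))
    where
    π : Permutation n n
    π = ↔-trans (↔-sym enum) (↔-trans (mk↔ₛ′ σ σ⁻¹ σσ⁻¹ σ⁻¹σ) enum)
    σ-elem : ∀ i → g (elem (π ⟨$⟩ʳ i)) ≡ g (σ (elem i))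
    σ-elem i = cong g (Inverse.strictlyInverseʳ enum _)

  ∑-exchange-at : (x₀ : X) (g h : X → A) → (∀ {x} → x ≢ x₀ → g x ≡ h x) → g x₀ ∙ ∑ h ≈ h x₀ ∙ ∑ g
  ∑-exchange-at x₀ g h g≗h = exchange elem (Inverse.to enum x₀) (Inverse.strictlyInverseʳ enum x₀)
    (λ j eⱼ≡x₀ → trans (sym (Inverse.strictlyInverseˡ enum j)) (cong (Inverse.to enum) eⱼ≡x₀))
    where
    exchange : ∀ {m} (e : Fin m → X) (i : Fin m) → e i ≡ x₀ → (∀ j → e j ≡ x₀ → j ≡ i) →
               g x₀ ∙ sum (h ∘ e) ≈ h x₀ ∙ sum (g ∘ e)
    exchange {suc m} e i eᵢ≡x₀ only-i = begin
      g x₀ ∙ sum (h ∘ e)                               ≈⟨ ∙-congˡ (sum-remove {i = i} (h ∘ e)) ⟩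
      g x₀ ∙ (h (e i) ∙ sum (h ∘ e ∘ punchIn i))       ≈⟨ ∙-congˡ (∙-cong (≈-reflexive (cong h eᵢ≡x₀)) (≈-reflexive (sum-cong-≗ away))) ⟩
      g x₀ ∙ (h x₀ ∙ sum (g ∘ e ∘ punchIn i))          ≈⟨ x∙yz≈y∙xz _ _ _ ⟩
      h x₀ ∙ (g x₀ ∙ sum (g ∘ e ∘ punchIn i))          ≈⟨ ∙-congˡ (∙-congʳ (≈-reflexive (cong g eᵢ≡x₀))) ⟨
      h x₀ ∙ (g (e i) ∙ sum (g ∘ e ∘ punchIn i))       ≈⟨ ∙-congˡ (sum-remove {i = i} (g ∘ e)) ⟨
      h x₀ ∙ sum (g ∘ e)                               ∎
      where
      away : ∀ j → h (e (punchIn i j)) ≡ g (e (punchIn i j))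
      away j = sym (g≗h (λ eⱼ≡x₀ → Fin.punchInᵢ≢i i j (only-i _ eⱼ≡x₀)))

module FieldProperties {q} (F : FiniteField q) where
  open FiniteField F public
  open PG F public

  commutativeRing : CommutativeRing _ _
  commutativeRing = record { isCommutativeRing = isCommutativeRing }

  open CommutativeRing commutativeRing public
    using (+-assoc; +-comm; *-assoc; *-comm; +-identityˡ; +-identityʳ; *-identityˡ; *-identityʳ;
           -‿inverseʳ; -‿inverseˡ; distribʳ; zeroˡ; zeroʳ;
           ring; semiring; +-commutativeMonoid; *-commutativeMonoid)
  open Algebra.Properties.Ring ring public
    using (-‿involutive; -0#≈0#; -‿distribʳ-*; +-identityʳ-unique; +-cancelʳ)
  open Algebra.Properties.Semiring.Mult semiring public using () renaming (_×_ to _·_)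
  open Algebra.Properties.Semiring.Exp semiring public using (_^_; ^-assocʳ)
  open Algebra.Properties.CommutativeSemiring.Exp (CommutativeRing.commutativeSemiring commutativeRing)
    using (^-distrib-*)
  open IntegerSolver commutativeRing public using (solve; _:=_; _:+_; _:*_; _:-_; :-_; con)
  open ≡-Reasoning

  _≟_ : DecidableEquality Carrier
  _≟_ = via-injection (↔⇒↣ card) Fin._≟_

  -- 0# ⁻¹ = 0# is a junk value.
  _⁻¹ : Carrier → Carrier
  x ⁻¹ with x ≟ 0#
  ... | yes _ = 0#
  ... | no x≢0 = proj₁ (inverse x x≢0)

  ⁻¹-inverseʳ : ∀ {x} → x ≢ 0# → x * x ⁻¹ ≡ 1#
  ⁻¹-inverseʳ {x} x≢0 with x ≟ 0#
  ... | yes x≡0 = contradiction x≡0 x≢0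
  ... | no x≢0′ = proj₂ (inverse x x≢0′)

  ⁻¹-inverseˡ : ∀ {x} → x ≢ 0# → x ⁻¹ * x ≡ 1#
  ⁻¹-inverseˡ x≢0 = trans (*-comm _ _) (⁻¹-inverseʳ x≢0)

  0⁻¹≡0 : 0# ⁻¹ ≡ 0#
  0⁻¹≡0 with 0# ≟ 0#
  ... | yes _  = refl
  ... | no 0≢0 = contradiction refl 0≢0

  1≢0 : 1# ≢ 0#
  1≢0 = 0≢1 ∘ sym

  ⁻¹-cancelˡ : ∀ {x} → x ≢ 0# → ∀ y → x ⁻¹ * (x * y) ≡ y
  ⁻¹-cancelˡ {x} x≢0 y = begin
    x ⁻¹ * (x * y)   ≡⟨ *-assoc _ _ _ ⟨
    x ⁻¹ * x * y     ≡⟨ cong (_* y) (⁻¹-inverseˡ x≢0) ⟩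
    1# * y           ≡⟨ *-identityˡ y ⟩
    y                ∎

  *-cancelˡ : ∀ {x a b} → x ≢ 0# → x * a ≡ x * b → a ≡ b
  *-cancelˡ {x} {a} {b} x≢0 eq = begin
    a                ≡⟨ ⁻¹-cancelˡ x≢0 a ⟨
    x ⁻¹ * (x * a)   ≡⟨ cong (x ⁻¹ *_) eq ⟩
    x ⁻¹ * (x * b)   ≡⟨ ⁻¹-cancelˡ x≢0 b ⟩
    b                ∎

  x*y≡0⇒y≡0 : ∀ {x y} → x ≢ 0# → x * y ≡ 0# → y ≡ 0#
  x*y≡0⇒y≡0 x≢0 xy≡0 = *-cancelˡ x≢0 (trans xy≡0 (sym (zeroʳ _)))

  x*y≡0⇒x≡0 : ∀ {x y} → y ≢ 0# → x * y ≡ 0# → x ≡ 0#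
  x*y≡0⇒x≡0 y≢0 xy≡0 = x*y≡0⇒y≡0 y≢0 (trans (*-comm _ _) xy≡0)

  *-≢0 : ∀ {x y} → x ≢ 0# → y ≢ 0# → x * y ≢ 0#
  *-≢0 x≢0 y≢0 = y≢0 ∘ x*y≡0⇒y≡0 x≢0

  x*y≡0⇒x≡0⊎y≡0 : ∀ {x y} → x * y ≡ 0# → x ≡ 0# ⊎ y ≡ 0#
  x*y≡0⇒x≡0⊎y≡0 {x} xy≡0 with x ≟ 0#
  ... | yes x≡0 = inj₁ x≡0
  ... | no x≢0  = inj₂ (x*y≡0⇒y≡0 x≢0 xy≡0)

  ⁻¹-≢0 : ∀ {x} → x ≢ 0# → x ⁻¹ ≢ 0#
  ⁻¹-≢0 {x} x≢0 x⁻¹≡0 = 1≢0 (trans (sym (⁻¹-inverseʳ x≢0)) (trans (cong (x *_) x⁻¹≡0) (zeroʳ x)))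

  -‿≢0 : ∀ {x} → x ≢ 0# → - x ≢ 0#
  -‿≢0 {x} x≢0 -x≡0 = x≢0 (trans (sym (-‿involutive x)) (trans (cong -_ -x≡0) -0#≈0#))

  x-y≡0⇒x≡y : ∀ {x y} → x + - y ≡ 0# → x ≡ y
  x-y≡0⇒x≡y {x} {y} eq = begin
    x                ≡⟨ solve 2 (λ x y → x := (x :- y) :+ y) refl x y ⟩
    (x + - y) + y    ≡⟨ cong (_+ y) eq ⟩
    0# + y           ≡⟨ +-identityˡ y ⟩
    y                ∎

  x+y≡0⇒x≡-y : ∀ {x y} → x + y ≡ 0# → x ≡ - y
  x+y≡0⇒x≡-y {x} {y} eq = begin
    x                ≡⟨ solve 2 (λ x y → x := (x :+ y) :- y) refl x y ⟩
    (x + y) + - y    ≡⟨ cong (_+ - y) eq ⟩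
    0# + - y         ≡⟨ +-identityˡ (- y) ⟩
    - y              ∎

  pow≡^ : ∀ x n → pow x n ≡ x ^ n
  pow≡^ x zero    = refl
  pow≡^ x (suc n) = cong (x *_) (pow≡^ x n)

  pow-distrib-* : ∀ x y n → pow (x * y) n ≡ pow x n * pow y n
  pow-distrib-* x y n = begin
    pow (x * y) n          ≡⟨ pow≡^ (x * y) n ⟩
    (x * y) ^ n            ≡⟨ ^-distrib-* x y n ⟩
    x ^ n * y ^ n          ≡⟨ sym (cong₂ _*_ (pow≡^ x n) (pow≡^ y n)) ⟩
    pow x n * pow y n      ∎

  pow-assoc : ∀ x m n → pow (pow x m) n ≡ pow x (m ℕ.* n)
  pow-assoc x m n = begin
    pow (pow x m) n        ≡⟨ pow≡^ (pow x m) n ⟩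
    pow x m ^ n            ≡⟨ cong (_^ n) (pow≡^ x m) ⟩
    (x ^ m) ^ n            ≡⟨ ^-assocʳ x m n ⟩
    x ^ (m ℕ.* n)          ≡⟨ pow≡^ x (m ℕ.* n) ⟨
    pow x (m ℕ.* n)        ∎

  N : ℕ
  N = q ℕ.^ 3

  module Σ+ = EnumeratedSum +-commutativeMonoid card
  module Π* = EnumeratedSum *-commutativeMonoid card

  -- Translation by 1 permutes F, so Σ (x + 1) = Σ x.
  N·1≡0 : N · 1# ≡ 0#
  N·1≡0 = +-identityʳ-unique (∑ id) (N · 1#) (begin
    ∑ id + N · 1#              ≡⟨ cong (∑ id +_) (sum-replicate N) ⟨
    ∑ id + ∑ (λ _ → 1#)        ≡⟨ ∑-distrib-+ elem (λ _ → 1#) ⟨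
    ∑ (_+ 1#)                  ≡⟨ ∑-reindex id (_+ 1#) (_+ - 1#) (λ x → solve 1 (λ x → x :- con 1ℤ :+ con 1ℤ := x) refl x)
                                                               (λ x → solve 1 (λ x → x :+ con 1ℤ :- con 1ℤ := x) refl x) ⟨
    ∑ id                       ∎)
    where
    open Σ+
    open CommutativeMonoidSum +-commutativeMonoid using (sum-replicate; ∑-distrib-+)

  private
    unit : Carrier → Carrier
    unit x with x ≟ 0#
    ... | yes _ = 1#
    ... | no _  = x

    unit-0 : unit 0# ≡ 1#
    unit-0 with 0# ≟ 0#
    ... | yes _   = refl
    ... | no 0≢0  = contradiction refl 0≢0

    unit-≢0 : ∀ {x} → x ≢ 0# → unit x ≡ x
    unit-≢0 {x} x≢0 with x ≟ 0#
    ... | yes x≡0 = contradiction x≡0 x≢0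
    ... | no _    = refl

    unit-nonzero : ∀ x → unit x ≢ 0#
    unit-nonzero x with x ≟ 0#
    ... | yes _   = 1≢0
    ... | no x≢0  = x≢0

  ∏-≢0 : ∀ {m} (t : Fin m → Carrier) → (∀ i → t i ≢ 0#) → Π*.sum t ≢ 0#
  ∏-≢0 {zero}  t t≢0 = 1≢0
  ∏-≢0 {suc m} t t≢0 = *-≢0 (t≢0 Fin.zero) (∏-≢0 (t ∘ Fin.suc) (t≢0 ∘ Fin.suc))

  -- For a ≠ 0 the products over x of unit (a x) and of a * unit x differ only in the factor at
  -- x = 0, and the first is ∏ unit because x ↦ a x permutes F.
  pow-N≡id : ∀ a → pow a N ≡ a
  pow-N≡id a with a ≟ 0#
  ... | yes refl = pow-0 (Inverse.to card 0#)
    where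
    pow-0 : ∀ {n} → Fin n → pow 0# n ≡ 0#
    pow-0 {suc n} _ = zeroˡ _
  ... | no a≢0 = *-cancelˡ (∏-≢0 (unit ∘ elem) (unit-nonzero ∘ elem)) (begin
    ∏ unit * pow a N                   ≡⟨ cong (∏ unit *_) (trans (pow≡^ a N) (sym (sum-replicate N))) ⟩
    ∏ unit * ∏ (λ _ → a)               ≡⟨ *-comm _ _ ⟩
    ∏ (λ _ → a) * ∏ unit               ≡⟨ ∑-distrib-+ (λ _ → a) (unit ∘ elem) ⟨
    ∏ (λ x → a * unit x)               ≡⟨ *-identityˡ _ ⟨
    1# * ∏ (λ x → a * unit x)          ≡⟨ cong (_* ∏ (λ x → a * unit x)) (trans (sym unit-0) (cong unit (sym (zeroʳ a)))) ⟩
    unit (a * 0#) * ∏ (λ x → a * unit x) ≡⟨ ∑-exchange-at 0# (unit ∘ (a *_)) (λ x → a * unit x) unit-a* ⟩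
    a * unit 0# * ∏ (unit ∘ (a *_))    ≡⟨ cong₂ _*_ (trans (cong (a *_) unit-0) (*-identityʳ a)) (sym (∑-reindex unit (a *_) (a ⁻¹ *_) a*a⁻¹ (⁻¹-cancelˡ a≢0))) ⟩
    a * ∏ unit                         ≡⟨ *-comm _ _ ⟩
    ∏ unit * a                         ∎)
    where
    open Π* renaming (∑ to ∏)
    open CommutativeMonoidSum *-commutativeMonoid using (sum-replicate; ∑-distrib-+)
    unit-a* : ∀ {x} → x ≢ 0# → unit (a * x) ≡ a * unit x
    unit-a* x≢0 = trans (unit-≢0 (*-≢0 a≢0 x≢0)) (cong (a *_) (sym (unit-≢0 x≢0)))
    a*a⁻¹ : ∀ x → a * (a ⁻¹ * x) ≡ x
    a*a⁻¹ x = trans (sym (*-assoc _ _ _)) (trans (cong (_* x) (⁻¹-inverseʳ a≢0)) (*-identityˡ x))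

  module Endomorphism (f : Carrier → Carrier)
    (+-homo : ∀ x y → f (x + y) ≡ f x + f y) (*-homo : ∀ x y → f (x * y) ≡ f x * f y) (1#-homo : f 1# ≡ 1#)
    where

    0#-homo : f 0# ≡ 0#
    0#-homo = +-identityʳ-unique (f 0#) (f 0#) (trans (sym (+-homo 0# 0#)) (cong f (+-identityʳ 0#)))

    -‿homo : ∀ x → f (- x) ≡ - f x
    -‿homo x = begin
      f (- x)                       ≡⟨ solve 2 (λ a b → b := a :+ b :- a) refl (f x) (f (- x)) ⟩
      f x + f (- x) + - f x         ≡⟨ cong (_+ - f x) (sym (+-homo x (- x))) ⟩
      f (x + - x) + - f x           ≡⟨ cong (λ z → f z + - f x) (-‿inverseʳ x) ⟩
      f 0# + - f x                  ≡⟨ cong (_+ - f x) 0#-homo ⟩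
      0# + - f x                    ≡⟨ +-identityˡ _ ⟩
      - f x                         ∎

    *⁻¹-homo : ∀ {x} → x ≢ 0# → f x * f (x ⁻¹) ≡ 1#
    *⁻¹-homo {x} x≢0 = trans (sym (*-homo x (x ⁻¹))) (trans (cong f (⁻¹-inverseʳ x≢0)) 1#-homo)

    ≢0 : ∀ {x} → x ≢ 0# → f x ≢ 0#
    ≢0 {x} x≢0 fx≡0 = 1≢0 (trans (sym (*⁻¹-homo x≢0)) (trans (cong (_* f (x ⁻¹)) fx≡0) (zeroˡ _)))

    ⁻¹-homo : ∀ {x} → x ≢ 0# → f (x ⁻¹) ≡ f x ⁻¹
    ⁻¹-homo x≢0 = *-cancelˡ (≢0 x≢0) (trans (*⁻¹-homo x≢0) (sym (⁻¹-inverseʳ (≢0 x≢0))))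

module Polynomials {q} (F : FiniteField q) where
  open FieldProperties F
  open ≡-Reasoning

  -- Coefficient lists, constant term first.
  Poly : Set
  Poly = List Carrier

  eval : Poly → Carrier → Carrier
  eval []       x = 0#
  eval (c ∷ cs) x = c + x * eval cs x

  Zero : Poly → Set
  Zero = All (_≡ 0#)

  eval-Zero : ∀ {cs} x → Zero cs → eval cs x ≡ 0#
  eval-Zero x []               = refl
  eval-Zero x (c≡0 ∷ cs≡0) = trans (cong₂ (λ c e → c + x * e) c≡0 (eval-Zero x cs≡0))
                                   (solve 1 (λ x → con 0ℤ :+ x :* con 0ℤ := con 0ℤ) refl x)

  quot : Carrier → Poly → Poly
  quot a []       = []
  quot a (d ∷ ds) = eval (d ∷ ds) a ∷ quot a ds

  length-quot : ∀ a cs → length (quot a cs) ≡ length cs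
  length-quot a []       = refl
  length-quot a (d ∷ ds) = cong suc (length-quot a ds)

  eval-quot : ∀ a c cs x → eval (c ∷ cs) x ≡ (x + - a) * eval (quot a cs) x + eval (c ∷ cs) a
  eval-quot a c []       x = solve 3 (λ a c x → c :+ x :* con 0ℤ := (x :- a) :* con 0ℤ :+ (c :+ a :* con 0ℤ)) refl a c x
  eval-quot a c (d ∷ ds) x = begin
    c + x * eval (d ∷ ds) x                  ≡⟨ cong (λ e → c + x * e) (eval-quot a d ds x) ⟩
    c + x * ((x + - a) * Q + E)              ≡⟨ solve 5 (λ c x a Q E → c :+ x :* ((x :- a) :* Q :+ E) := (x :- a) :* (E :+ x :* Q) :+ (c :+ a :* E)) refl c x a Q E ⟩
    (x + - a) * (E + x * Q) + (c + a * E)    ∎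
    where
    Q = eval (quot a ds) x
    E = eval (d ∷ ds) a

  root-head : ∀ {a c cs} → Zero cs → eval (c ∷ cs) a ≡ 0# → c ≡ 0#
  root-head {a} {c} {cs} cs≡0 root = begin
    c                  ≡⟨ solve 2 (λ c a → c := c :+ a :* con 0ℤ) refl c a ⟩
    c + a * 0#         ≡⟨ cong (λ e → c + a * e) (eval-Zero a cs≡0) ⟨
    eval (c ∷ cs) a    ≡⟨ root ⟩
    0#                 ∎

  Zero-quot : ∀ a cs → Zero (quot a cs) → Zero cs
  Zero-quot a []       _              = []
  Zero-quot a (d ∷ ds) (root ∷ quot≡0) = root-head ds≡0 root ∷ ds≡0
    where ds≡0 = Zero-quot a ds quot≡0

  vanishing⇒Zero : ∀ P R → length P ≤ length R → Unique R → All (λ r → eval P r ≡ 0#) R → Zero P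
  vanishing⇒Zero []       _       _         _              _              = []
  vanishing⇒Zero (c ∷ cs) (a ∷ R) (s≤s |cs|≤|R|) (a∉R ∷ R!) (root ∷ roots) = root-head cs≡0 root ∷ cs≡0
    where
    quot-root : ∀ {r} → a ≢ r → eval (c ∷ cs) r ≡ 0# → eval (quot a cs) r ≡ 0#
    quot-root {r} a≢r r-root = x*y≡0⇒y≡0 (λ r-a≡0 → a≢r (sym (x-y≡0⇒x≡y r-a≡0))) (begin
      (r + - a) * eval (quot a cs) r                      ≡⟨ +-identityʳ _ ⟨
      (r + - a) * eval (quot a cs) r + 0#                 ≡⟨ cong ((r + - a) * eval (quot a cs) r +_) root ⟨
      (r + - a) * eval (quot a cs) r + eval (c ∷ cs) a    ≡⟨ eval-quot a c cs r ⟨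
      eval (c ∷ cs) r                                     ≡⟨ r-root ⟩
      0#                                                  ∎)
    quot-roots : All (λ r → eval (quot a cs) r ≡ 0#) R
    quot-roots = All.zipWith (λ (a≢r , r-root) → quot-root a≢r r-root) (a∉R , roots)
    cs≡0 : Zero cs
    cs≡0 = Zero-quot a cs (vanishing⇒Zero (quot a cs) R (subst (_≤ length R) (sym (length-quot a cs)) |cs|≤|R|) R! quot-roots)

  infix  8 X^_
  infixl 6 _+ₚ_

  X^_ : ℕ → Poly
  X^ zero    = 1# ∷ []
  X^ (suc n) = 0# ∷ X^ n

  _+ₚ_ : Poly → Poly → Poly
  []      +ₚ Q       = Q
  (c ∷ P) +ₚ []      = c ∷ P
  (c ∷ P) +ₚ (d ∷ Q) = (c + d) ∷ (P +ₚ Q)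

  eval-X^ : ∀ n x → eval (X^ n) x ≡ pow x n
  eval-X^ zero    x = solve 1 (λ x → con 1ℤ :+ x :* con 0ℤ := con 1ℤ) refl x
  eval-X^ (suc n) x = trans (cong (λ e → 0# + x * e) (eval-X^ n x)) (+-identityˡ _)

  eval-+ₚ : ∀ P Q x → eval (P +ₚ Q) x ≡ eval P x + eval Q x
  eval-+ₚ []      Q       x = sym (+-identityˡ _)
  eval-+ₚ (c ∷ P) []      x = sym (+-identityʳ _)
  eval-+ₚ (c ∷ P) (d ∷ Q) x = begin
    (c + d) + x * eval (P +ₚ Q) x                 ≡⟨ cong (λ e → (c + d) + x * e) (eval-+ₚ P Q x) ⟩
    (c + d) + x * (eval P x + eval Q x)           ≡⟨ solve 5 (λ c d x u v → (c :+ d) :+ x :* (u :+ v) := (c :+ x :* u) :+ (d :+ x :* v)) refl c d x (eval P x) (eval Q x) ⟩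
    (c + x * eval P x) + (d + x * eval Q x)       ∎

  length-X^ : ∀ n → length (X^ n) ≡ suc n
  length-X^ zero    = refl
  length-X^ (suc n) = cong suc (length-X^ n)

  length-X^+ₚ : ∀ n Q → length Q ≤ n → length (X^ n +ₚ Q) ≡ suc n
  length-X^+ₚ zero    []      _               = refl
  length-X^+ₚ (suc n) []      _               = length-X^ (suc n)
  length-X^+ₚ (suc n) (d ∷ Q) (s≤s |Q|≤n)     = cong suc (length-X^+ₚ n Q |Q|≤n)

  X^+ₚ-nonZero : ∀ n Q → length Q ≤ n → ¬ Zero (X^ n +ₚ Q)
  X^+ₚ-nonZero zero    []      _           (1≡0 ∷ _) = 1≢0 1≡0
  X^+ₚ-nonZero (suc n) []      _           (_ ∷ X^n≡0) = X^-nonZero n X^n≡0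
    where
    X^-nonZero : ∀ n → ¬ Zero (X^ n)
    X^-nonZero zero    (1≡0 ∷ _)   = 1≢0 1≡0
    X^-nonZero (suc n) (_ ∷ X^n≡0) = X^-nonZero n X^n≡0
  X^+ₚ-nonZero (suc n) (d ∷ Q) (s≤s |Q|≤n) (_ ∷ P≡0)   = X^+ₚ-nonZero n Q |Q|≤n P≡0

  root-bound : ∀ n Q → length Q ≤ n → ∀ {R} → Unique R → All (λ r → pow r n + eval Q r ≡ 0#) R → length R ≤ n
  root-bound n Q |Q|≤n {R} R! roots with length R ℕ.≤? n
  ... | yes |R|≤n = |R|≤n
  ... | no  |R|≰n = contradiction (vanishing⇒Zero (X^ n +ₚ Q) R |P|≤|R| R! P-roots) (X^+ₚ-nonZero n Q |Q|≤n)
    where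
    |P|≤|R| : length (X^ n +ₚ Q) ≤ length R
    |P|≤|R| = subst (_≤ length R) (sym (length-X^+ₚ n Q |Q|≤n)) (ℕ.≰⇒> |R|≰n)
    P-roots : All (λ r → eval (X^ n +ₚ Q) r ≡ 0#) R
    P-roots = All.map (λ {r} root → trans (eval-+ₚ (X^ n) Q r) (trans (cong (_+ eval Q r) (eval-X^ n r)) root)) roots

module FrobeniusMap {q} (F : FiniteField q) (q-prime-power : IsPrimePower q) where
  open FieldProperties F public
  open ≡-Reasoning

  private
    p = proj₁ q-prime-power
    k = proj₁ (proj₂ q-prime-power)
    p-prime : Prime p
    p-prime = proj₁ (proj₂ (proj₂ q-prime-power))
    k≥1 : k ℕ.≥ 1
    k≥1 = proj₁ (proj₂ (proj₂ (proj₂ q-prime-power)))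
    q≡p^k : q ≡ p ℕ.^ k
    q≡p^k = proj₂ (proj₂ (proj₂ (proj₂ q-prime-power)))

    p∣q : p ∣ q
    p∣q = subst (p ∣_) (sym q≡p^k) (p∣p^k k k≥1)
      where
      p∣p^k : ∀ k → 1 ≤ k → p ∣ p ℕ.^ k
      p∣p^k (suc j) _ = m∣m*n (p ℕ.^ j)

  q≢0 : ℕ.NonZero q
  q≢0 = subst ℕ.NonZero (sym q≡p^k) (ℕ.m^n≢0 p k {{prime⇒nonZero p-prime}})

  2≤q : 2 ≤ q
  2≤q = ℕ.≤-trans (ℕ.nonTrivial⇒n>1 p {{prime⇒nonTrivial p-prime}}) (∣⇒≤ {{q≢0}} p∣q)

  p·1≡0 : p · 1# ≡ 0#
  p·1≡0 = p^j·1≡0⇒p·1≡0 (k ℕ.* 3) (trans (cong (_· 1#) p^[3k]≡N) N·1≡0)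
    where
    open Algebra.Properties.Semiring.Mult semiring using (×1-homo-*)
    p^[3k]≡N : p ℕ.^ (k ℕ.* 3) ≡ N
    p^[3k]≡N = trans (sym (ℕ.^-*-assoc p k 3)) (cong (ℕ._^ 3) (sym q≡p^k))
    p^j·1≡0⇒p·1≡0 : ∀ j → (p ℕ.^ j) · 1# ≡ 0# → p · 1# ≡ 0#
    p^j·1≡0⇒p·1≡0 zero    1+0≡0 = contradiction (trans (sym (+-identityʳ 1#)) 1+0≡0) 1≢0
    p^j·1≡0⇒p·1≡0 (suc j) eq with x*y≡0⇒x≡0⊎y≡0 (trans (sym (×1-homo-* p (p ℕ.^ j))) eq)
    ... | inj₁ p·1≡0   = p·1≡0
    ... | inj₂ p^j·1≡0 = p^j·1≡0⇒p·1≡0 j p^j·1≡0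

  fr-homo-+ : ∀ x y → fr (x + y) ≡ fr x + fr y
  fr-homo-+ x y = begin
    pow (x + y) q                          ≡⟨ pow≡^ (x + y) q ⟩
    (x + y) ^ q                            ≡⟨ cong ((x + y) ^_) q≡p^k ⟩
    (x + y) ^ (p ℕ.^ k)                    ≡⟨ Frobenius.^p^j-homo-+ commutativeRing p-prime p·1≡0 k x y ⟩
    x ^ (p ℕ.^ k) + y ^ (p ℕ.^ k)          ≡⟨ cong (λ n → x ^ n + y ^ n) q≡p^k ⟨
    x ^ q + y ^ q                          ≡⟨ cong₂ _+_ (pow≡^ x q) (pow≡^ y q) ⟨
    pow x q + pow y q                      ∎

  fr-homo-* : ∀ x y → fr (x * y) ≡ fr x * fr y
  fr-homo-* x y = pow-distrib-* x y q

  pow-1# : ∀ n → pow 1# n ≡ 1#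
  pow-1# zero    = refl
  pow-1# (suc n) = trans (*-identityˡ _) (pow-1# n)

  module Fr = Endomorphism fr fr-homo-+ fr-homo-* (pow-1# q)

  fr∘fr≡fr2 : ∀ x → fr (fr x) ≡ fr2 x
  fr∘fr≡fr2 x = trans (pow-assoc x q q) (cong (pow x) (cong (q ℕ.*_) (sym (ℕ.*-identityʳ q))))

  fr∘fr2≡id : ∀ x → fr (fr2 x) ≡ x
  fr∘fr2≡id x = trans (pow-assoc x (q ℕ.^ 2) q) (trans (cong (pow x) (ℕ.*-comm (q ℕ.^ 2) q)) (pow-N≡id x))

  fr2∘fr≡id : ∀ x → fr2 (fr x) ≡ x
  fr2∘fr≡id x = trans (pow-assoc x q (q ℕ.^ 2)) (pow-N≡id x)

  fr2≡fr∘fr : ∀ x → fr2 x ≡ fr (fr x)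
  fr2≡fr∘fr x = sym (fr∘fr≡fr2 x)

  fr2-homo-+ : ∀ x y → fr2 (x + y) ≡ fr2 x + fr2 y
  fr2-homo-+ x y = begin
    fr2 (x + y)              ≡⟨ fr2≡fr∘fr (x + y) ⟩
    fr (fr (x + y))          ≡⟨ cong fr (fr-homo-+ x y) ⟩
    fr (fr x + fr y)         ≡⟨ fr-homo-+ (fr x) (fr y) ⟩
    fr (fr x) + fr (fr y)    ≡⟨ cong₂ _+_ (fr∘fr≡fr2 x) (fr∘fr≡fr2 y) ⟩
    fr2 x + fr2 y            ∎

  fr2-homo-* : ∀ x y → fr2 (x * y) ≡ fr2 x * fr2 y
  fr2-homo-* x y = pow-distrib-* x y (q ℕ.^ 2)

  module Fr2 = Endomorphism fr2 fr2-homo-+ fr2-homo-* (pow-1# (q ℕ.^ 2))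

  fr2∘fr2≡fr : ∀ x → fr2 (fr2 x) ≡ fr x
  fr2∘fr2≡fr x = trans (fr2≡fr∘fr _) (cong fr (fr∘fr2≡id x))

  private
    prime∣m^n⇒prime∣m : ∀ {r m} n → Prime r → r ∣ m ℕ.^ n → r ∣ m
    prime∣m^n⇒prime∣m zero    r-prime r∣1 = contradiction (∣1⇒≡1 r∣1) (ℕ.>⇒≢ (ℕ.nonTrivial⇒n>1 _ {{prime⇒nonTrivial r-prime}}))
    prime∣m^n⇒prime∣m {m = m} (suc n) r-prime r∣m^[1+n] with euclidsLemma m (m ℕ.^ n) r-prime r∣m^[1+n]
    ... | inj₁ r∣m   = r∣m
    ... | inj₂ r∣m^n = prime∣m^n⇒prime∣m n r-prime r∣m^n

    2-prime : Prime 2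
    2-prime = from-yes (prime? 2)

  2∣q⇒1+1≡0 : 2 ∣ q → 1# + 1# ≡ 0#
  2∣q⇒1+1≡0 2∣q with prime⇒irreducible p-prime (prime∣m^n⇒prime∣m k 2-prime (subst (2 ∣_) q≡p^k 2∣q))
  ... | inj₂ refl = trans (cong (1# +_) (sym (+-identityʳ 1#))) p·1≡0

  ¬2∣q⇒1+1≢0 : ¬ 2 ∣ q → 1# + 1# ≢ 0#
  ¬2∣q⇒1+1≢0 ¬2∣q 1+1≡0 = 1≢0 (begin
    1#                                  ≡⟨ +-identityʳ 1# ⟨
    1# + 0#                             ≡⟨ cong (1# +_) (trans (sym (zeroʳ _)) (cong (m · 1# *_) (sym 1+1≡0))) ⟩
    1# + m · 1# * (1# + 1#)             ≡⟨ cong (λ t → 1# + m · 1# * (1# + t)) (+-identityʳ 1#) ⟨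
    1# + m · 1# * 2 · 1#                ≡⟨ cong (1# +_) (×1-homo-* m 2) ⟨
    (1 ℕ.+ m ℕ.* 2) · 1#                ≡⟨ cong (_· 1#) p≡1+2m ⟨
    p · 1#                              ≡⟨ p·1≡0 ⟩
    0#                                  ∎)
    where
    open Algebra.Properties.Semiring.Mult semiring using (×1-homo-*)
    m = p / 2
    p%2≡1 : p % 2 ≡ 1
    p%2≡1 with p % 2 | m%n<n p 2 | m%n≡0⇒n∣m p 2
    ... | 0           | _                  | 2∣p = contradiction (∣-trans (2∣p refl) p∣q) ¬2∣q
    ... | 1           | _                  | _   = refl
    ... | suc (suc _) | s≤s (s≤s ())       | _
    p≡1+2m : p ≡ 1 ℕ.+ m ℕ.* 2
    p≡1+2m = trans (m≡m%n+[m/n]*n p 2) (cong (ℕ._+ m ℕ.* 2) p%2≡1)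

module TraceForm {q} (F : FiniteField q) (q-prime-power : IsPrimePower q) where
  open FrobeniusMap F q-prime-power public
  open ≡-Reasoning

  -- membership in the subfield F_q
  Fixed : Carrier → Set
  Fixed t = fr t ≡ t

  Fixed-0# : Fixed 0#
  Fixed-0# = Fr.0#-homo

  Fixed-1# : Fixed 1#
  Fixed-1# = pow-1# q

  Fixed-neg : ∀ {a} → Fixed a → Fixed (- a)
  Fixed-neg a∈K = trans (Fr.-‿homo _) (cong -_ a∈K)

  Fixed-+ : ∀ {a b} → Fixed a → Fixed b → Fixed (a + b)
  Fixed-+ a∈K b∈K = trans (fr-homo-+ _ _) (cong₂ _+_ a∈K b∈K)

  Fixed-* : ∀ {a b} → Fixed a → Fixed b → Fixed (a * b)
  Fixed-* a∈K b∈K = trans (fr-homo-* _ _) (cong₂ _*_ a∈K b∈K)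

  Fixed-⁻¹ : ∀ {a} → Fixed a → Fixed (a ⁻¹)
  Fixed-⁻¹ {a} a∈K = by-cases (a ≟ 0#)
    where
    by-cases : Dec (a ≡ 0#) → Fixed (a ⁻¹)
    by-cases (yes a≡0) = subst (Fixed ∘ _⁻¹) (sym a≡0) (subst Fixed (sym 0⁻¹≡0) Fixed-0#)
    by-cases (no a≢0)  = trans (Fr.⁻¹-homo a≢0) (cong _⁻¹ a∈K)

  fr2-Fixed : ∀ {a} → Fixed a → fr2 a ≡ a
  fr2-Fixed {a} a∈K = trans (fr2≡fr∘fr a) (trans (cong fr a∈K) a∈K)

  Tr : Carrier → Carrier
  Tr x = x + fr x + fr2 x

  Tr-homo-+ : ∀ x y → Tr (x + y) ≡ Tr x + Tr y
  Tr-homo-+ x y = begin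
    (x + y) + fr (x + y) + fr2 (x + y)                        ≡⟨ cong₂ (λ a b → (x + y) + a + b) (fr-homo-+ x y) (fr2-homo-+ x y) ⟩
    (x + y) + (fr x + fr y) + (fr2 x + fr2 y)
      ≡⟨ solve 6 (λ a b c d e f → (a :+ b) :+ (c :+ d) :+ (e :+ f) := (a :+ c :+ e) :+ (b :+ d :+ f))
                 refl x y (fr x) (fr y) (fr2 x) (fr2 y) ⟩
    Tr x + Tr y                                               ∎

  Tr-homo-neg : ∀ x → Tr (- x) ≡ - Tr x
  Tr-homo-neg x = begin
    - x + fr (- x) + fr2 (- x)     ≡⟨ cong₂ (λ a b → - x + a + b) (Fr.-‿homo x) (Fr2.-‿homo x) ⟩
    - x + - fr x + - fr2 x         ≡⟨ solve 3 (λ a b c → (:- a) :+ (:- b) :+ (:- c) := :- (a :+ b :+ c)) refl x (fr x) (fr2 x) ⟩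
    - Tr x                         ∎

  Tr-homo-sub : ∀ x y → Tr (x + - y) ≡ Tr x + - Tr y
  Tr-homo-sub x y = trans (Tr-homo-+ x (- y)) (cong (Tr x +_) (Tr-homo-neg y))

  Tr-linear : ∀ {a} x → Fixed a → Tr (a * x) ≡ a * Tr x
  Tr-linear {a} x a∈K = begin
    a * x + fr (a * x) + fr2 (a * x)          ≡⟨ cong₂ (λ b c → a * x + b + c) (fr-homo-* a x) (fr2-homo-* a x) ⟩
    a * x + fr a * fr x + fr2 a * fr2 x       ≡⟨ cong₂ (λ b c → a * x + b * fr x + c * fr2 x) a∈K (fr2-Fixed a∈K) ⟩
    a * x + a * fr x + a * fr2 x              ≡⟨ solve 4 (λ a b c d → a :* b :+ a :* c :+ a :* d := a :* (b :+ c :+ d)) refl a x (fr x) (fr2 x) ⟩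
    a * Tr x                                  ∎

  Tr-Fixed : ∀ x → Fixed (Tr x)
  Tr-Fixed x = begin
    fr (x + fr x + fr2 x)          ≡⟨ trans (fr-homo-+ _ _) (cong (_+ fr (fr2 x)) (fr-homo-+ _ _)) ⟩
    fr x + fr (fr x) + fr (fr2 x)  ≡⟨ cong₂ (λ a b → fr x + a + b) (fr∘fr≡fr2 x) (fr∘fr2≡id x) ⟩
    fr x + fr2 x + x               ≡⟨ solve 3 (λ a b c → b :+ c :+ a := a :+ b :+ c) refl x (fr x) (fr2 x) ⟩
    Tr x                           ∎

  Tr∘fr≡Tr : ∀ x → Tr (fr x) ≡ Tr x
  Tr∘fr≡Tr x = begin
    fr x + fr (fr x) + fr2 (fr x)  ≡⟨ cong₂ (λ a b → fr x + a + b) (fr∘fr≡fr2 x) (fr2∘fr≡id x) ⟩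
    fr x + fr2 x + x               ≡⟨ solve 3 (λ a b c → b :+ c :+ a := a :+ b :+ c) refl x (fr x) (fr2 x) ⟩
    Tr x                           ∎

  Traceless : Carrier → Set
  Traceless w = Tr w ≡ 0#

module TraceCounting {q} (F : FiniteField q) (q-prime-power : IsPrimePower q) where
  open TraceForm F q-prime-power public
  open Polynomials F
  open ≡-Reasoning

  1+q≤q² : suc q ≤ q ℕ.^ 2
  1+q≤q² = 1+n≤n² 2≤q

  elements : List Carrier
  elements = tabulate (Inverse.from card)

  elements! : Unique elements
  elements! = Unique.tabulate⁺ (λ {i} {j} eq → trans (sym (Inverse.strictlyInverseˡ card i)) (trans (cong (Inverse.to card) eq) (Inverse.strictlyInverseˡ card j)))

  ∈-elements : ∀ x → x ∈ elements
  ∈-elements x = subst (_∈ elements) (Inverse.strictlyInverseʳ card x) (∈-tabulate⁺ (Inverse.to card x))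

  fixed : List Carrier
  fixed = filter (λ t → fr t ≟ t) elements

  fixed! : Unique fixed
  fixed! = Unique.filter⁺ _ elements!

  ∈-fixed : ∀ {t} → Fixed t → t ∈ fixed
  ∈-fixed {t} t∈K = ∈-filter⁺ _ (∈-elements t) t∈K

  fixed⇒Fixed : ∀ {t} → t ∈ fixed → Fixed t
  fixed⇒Fixed t∈fixed = proj₂ (∈-filter⁻ (λ t → fr t ≟ t) {xs = elements} t∈fixed)

  traceless : List Carrier
  traceless = filter (λ w → Tr w ≟ 0#) elements

  traceless! : Unique traceless
  traceless! = Unique.filter⁺ _ elements!

  ∈-traceless : ∀ {w} → Traceless w → w ∈ traceless
  ∈-traceless {w} Trw≡0 = ∈-filter⁺ _ (∈-elements w) Trw≡0

  traceless⇒Traceless : ∀ {w} → w ∈ traceless → Traceless w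
  traceless⇒Traceless w∈traceless = proj₂ (∈-filter⁻ (λ w → Tr w ≟ 0#) {xs = elements} w∈traceless)

  Fixed-bound : ∀ {R} → Unique R → All Fixed R → length R ≤ q
  Fixed-bound R! R⊆K = root-bound q (0# ∷ - 1# ∷ []) 2≤q R! (All.map root R⊆K)
    where
    root : ∀ {r} → Fixed r → pow r q + eval (0# ∷ - 1# ∷ []) r ≡ 0#
    root {r} r∈K = trans (cong (_+ eval (0# ∷ - 1# ∷ []) r) r∈K)
                         (solve 1 (λ r → r :+ (con 0ℤ :+ r :* (:- con 1ℤ :+ r :* con 0ℤ)) := con 0ℤ) refl r)

  Traceless-bound : ∀ {R} → Unique R → All Traceless R → length R ≤ q ℕ.^ 2
  Traceless-bound R! R⊆W = root-bound (q ℕ.^ 2) (X^ q +ₚ X^ 1) |X^q+X|≤q² R! (All.map root R⊆W)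
    where
    |X^q+X|≤q² : length (X^ q +ₚ X^ 1) ≤ q ℕ.^ 2
    |X^q+X|≤q² = subst (_≤ q ℕ.^ 2) (sym (length-X^+ₚ q (X^ 1) 2≤q)) 1+q≤q²
    root : ∀ {r} → Traceless r → pow r (q ℕ.^ 2) + eval (X^ q +ₚ X^ 1) r ≡ 0#
    root {r} Trr≡0 = begin
      fr2 r + eval (X^ q +ₚ X^ 1) r      ≡⟨ cong (fr2 r +_) (trans (eval-+ₚ (X^ q) (X^ 1) r) (cong₂ _+_ (eval-X^ q r) (eval-X^ 1 r))) ⟩
      fr2 r + (fr r + r * 1#)            ≡⟨ solve 3 (λ a b c → c :+ (b :+ a :* con 1ℤ) := a :+ b :+ c) refl r (fr r) (fr2 r) ⟩
      Tr r                               ≡⟨ Trr≡0 ⟩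
      0#                                 ∎

  private
    translate! : ∀ a {Y} → Unique Y → Unique (map (_+ - a) Y)
    translate! a = Unique.map⁺ (λ {x} {y} eq → begin
      x                ≡⟨ solve 2 (λ x a → x := x :- a :+ a) refl x a ⟩
      x + - a + a      ≡⟨ cong (_+ a) eq ⟩
      y + - a + a      ≡⟨ solve 2 (λ y a → y :- a :+ a := y) refl y a ⟩
      y                ∎)

    translate-bound : ∀ {P : Carrier → Set} {Y} (f : Carrier → Carrier) {b} →
                      (∀ {y y₀ t} → f y ≡ t → f y₀ ≡ t → P (y + - y₀)) →
                      (∀ {R} → Unique R → All P R → length R ≤ b) →
                      ∀ {t} → Unique Y → All (λ y → f y ≡ t) Y → length Y ≤ b
    translate-bound {Y = []}     f _ _ _ _ = z≤n
    translate-bound {Y = y₀ ∷ Y} f {b} P-diff P-bound Y! fY≡t =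
      subst (_≤ b) (length-map (_+ - y₀) (y₀ ∷ Y))
            (P-bound (translate! y₀ Y!) (All.map⁺ (All.map (λ fy≡t → P-diff fy≡t (All.head fY≡t)) fY≡t)))

  Tr-fibre-bound : ∀ t {Y} → Unique Y → All (λ y → Tr y ≡ t) Y → length Y ≤ q ℕ.^ 2
  Tr-fibre-bound t = translate-bound Tr Traceless-difference Traceless-bound
    where
    Traceless-difference : ∀ {y y₀ t} → Tr y ≡ t → Tr y₀ ≡ t → Traceless (y + - y₀)
    Traceless-difference {y} {y₀} {t} Tr-y≡t Tr-y₀≡t = begin
      Tr (y + - y₀)       ≡⟨ Tr-homo-sub y y₀ ⟩
      Tr y + - Tr y₀      ≡⟨ cong₂ (λ a b → a + - b) Tr-y≡t Tr-y₀≡t ⟩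
      t + - t             ≡⟨ -‿inverseʳ t ⟩
      0#                  ∎

  -- The fibres of D are cosets of F_q.
  D : Carrier → Carrier
  D x = x + - fr x

  D-Traceless : ∀ x → Traceless (D x)
  D-Traceless x = trans (Tr-homo-sub x (fr x)) (trans (cong (λ t → Tr x + - t) (Tr∘fr≡Tr x)) (-‿inverseʳ _))

  D-fibre-bound : ∀ t {Y} → Unique Y → All (λ y → D y ≡ t) Y → length Y ≤ q
  D-fibre-bound t = translate-bound D Fixed-difference Fixed-bound
    where
    fr-via-D : ∀ {y t} → D y ≡ t → fr y ≡ y + - t
    fr-via-D {y} Dy≡t = trans (solve 2 (λ y f → f := y :- (y :- f)) refl y (fr y)) (cong (λ s → y + - s) Dy≡t)
    Fixed-difference : ∀ {y y₀ t} → D y ≡ t → D y₀ ≡ t → Fixed (y + - y₀)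
    Fixed-difference {y} {y₀} {t} Dy≡t Dy₀≡t = begin
      fr (y + - y₀)                ≡⟨ trans (fr-homo-+ y (- y₀)) (cong (fr y +_) (Fr.-‿homo y₀)) ⟩
      fr y + - fr y₀               ≡⟨ cong₂ (λ a b → a + - b) (fr-via-D Dy≡t) (fr-via-D Dy₀≡t) ⟩
      (y + - t) + - (y₀ + - t)     ≡⟨ solve 3 (λ y y₀ t → (y :- t) :+ (:- (y₀ :- t)) := y :- y₀) refl y y₀ t ⟩
      y + - y₀                     ∎

  |fixed|≡q : length fixed ≡ q
  |fixed|≡q = ℕ.≤-antisym (Fixed-bound fixed! (All.tabulate fixed⇒Fixed)) q≤|fixed|
    where
    open ImageCounting _≟_ Tr (q ℕ.^ 2) Tr-fibre-bound
    q≤|fixed| : q ≤ length fixed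
    q≤|fixed| = ℕ.*-cancelˡ-≤ (q ℕ.^ 2) {{ℕ.m^n≢0 q 2 {{q≢0}}}}
                  (subst (_≤ q ℕ.^ 2 ℕ.* length fixed) (trans (length-tabulate (Inverse.from card)) (ℕ.*-comm q (q ℕ.^ 2)))
                  (image-bound fixed elements! (All.tabulate (λ {x} _ → ∈-fixed (Tr-Fixed x)))))

  q²≤|traceless| : q ℕ.^ 2 ≤ length traceless
  q²≤|traceless| = ℕ.*-cancelˡ-≤ q {{q≢0}} (subst (_≤ q ℕ.* length traceless) (length-tabulate (Inverse.from card))
                     (image-bound traceless elements! (All.tabulate (λ {x} _ → ∈-traceless (D-Traceless x)))))
    where
    open ImageCounting _≟_ D q D-fibre-bound

  private
    cast-cast : ∀ {m n} (eq : m ≡ n) (i : Fin n) → Fin.cast eq (Fin.cast (sym eq) i) ≡ i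
    cast-cast eq i = trans (Fin.cast-trans (sym eq) eq i) (Fin.cast-is-id refl i)

  fixedAt : Fin q → Carrier
  fixedAt i = lookup fixed (Fin.cast (sym |fixed|≡q) i)

  fixedAt-Fixed : ∀ i → Fixed (fixedAt i)
  fixedAt-Fixed i = fixed⇒Fixed (∈-lookup (Fin.cast (sym |fixed|≡q) i))

  fixedAt-injective : ∀ {i j} → fixedAt i ≡ fixedAt j → i ≡ j
  fixedAt-injective {i} {j} eq = begin
    i                                                       ≡⟨ cast-cast |fixed|≡q i ⟨
    Fin.cast |fixed|≡q (Fin.cast (sym |fixed|≡q) i)          ≡⟨ cong (Fin.cast |fixed|≡q) (lookup-injective fixed! _ _ eq) ⟩
    Fin.cast |fixed|≡q (Fin.cast (sym |fixed|≡q) j)          ≡⟨ cast-cast |fixed|≡q j ⟩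
    j                                                       ∎

  fixedAt-surjective : ∀ {t} → Fixed t → Σ[ i ∈ Fin q ] fixedAt i ≡ t
  fixedAt-surjective t∈K = Fin.cast |fixed|≡q (Any.index t∈fixed) ,
    trans (cong (lookup fixed) (cast-cast (sym |fixed|≡q) (Any.index t∈fixed))) (sym (Any.lookup-index t∈fixed))
    where t∈fixed = ∈-fixed t∈K

module TracelessBasis {q} (F : FiniteField q) (q-prime-power : IsPrimePower q) where
  open TraceCounting F q-prime-power public
  open import Data.List.Membership.DecPropositional _≟_ using (_∈?_)
  open ≡-Reasoning

  private
    open ListCounting _≟_ using (∃-∉)

    u-choice : Σ[ u ∈ Carrier ] u ∈ traceless × u ∉ (0# ∷ [])
    u-choice = ∃-∉ (0# ∷ []) traceless! (ℕ.≤-trans (ℕ.≤-trans (ℕ.≤-trans 2≤q (ℕ.n≤1+n q)) 1+q≤q²) q²≤|traceless|)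

  u : Carrier
  u = proj₁ u-choice

  u-Traceless : Traceless u
  u-Traceless = traceless⇒Traceless (proj₁ (proj₂ u-choice))

  u≢0 : u ≢ 0#
  u≢0 u≡0 = proj₂ (proj₂ u-choice) (here u≡0)

  private
    v-choice : Σ[ v ∈ Carrier ] v ∈ traceless × v ∉ map (_* u) fixed
    v-choice = ∃-∉ (map (_* u) fixed) traceless!
                   (ℕ.≤-trans (subst (λ n → suc n ≤ q ℕ.^ 2) (sym (trans (length-map (_* u) fixed) |fixed|≡q)) 1+q≤q²) q²≤|traceless|)

  v : Carrier
  v = proj₁ v-choice

  v-Traceless : Traceless v
  v-Traceless = traceless⇒Traceless (proj₁ (proj₂ v-choice))

  v∉Ku : ∀ {t} → Fixed t → v ≢ t * u
  v∉Ku t∈K v≡tu = proj₂ (proj₂ v-choice) (subst (_∈ map (_* u) fixed) (sym v≡tu) (∈-map⁺ (_* u) (∈-fixed t∈K)))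

  module Basis {u v} (u-Traceless : Traceless u) (v-Traceless : Traceless v) (u≢0 : u ≢ 0#) (v∉Ku : ∀ {t} → Fixed t → v ≢ t * u) where

    coordinates-unique : ∀ {α β α′ β′} → Fixed α → Fixed β → Fixed α′ → Fixed β′ →
                         α * u + β * v ≡ α′ * u + β′ * v → α ≡ α′ × β ≡ β′
    coordinates-unique {α} {β} {α′} {β′} α∈K β∈K α′∈K β′∈K eq with β ≟ β′
    ... | yes refl = *-cancelˡ u≢0 (trans (*-comm u α) (trans (+-cancelʳ (β * v) (α * u) (α′ * u) eq) (*-comm α′ u))) , refl
    ... | no β≢β′  = contradiction v≡cu (v∉Ku c∈K)
      where
      d = β + - β′
      c = (α′ + - α) * d ⁻¹
      c∈K : Fixed c
      c∈K = Fixed-* (Fixed-+ α′∈K (Fixed-neg α∈K)) (Fixed-⁻¹ (Fixed-+ β∈K (Fixed-neg β′∈K)))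
      d≢0 : d ≢ 0#
      d≢0 d≡0 = β≢β′ (x-y≡0⇒x≡y d≡0)
      dv≡[α′-α]u : d * v ≡ (α′ + - α) * u
      dv≡[α′-α]u = x-y≡0⇒x≡y (begin
        d * v + - ((α′ + - α) * u)
          ≡⟨ solve 6 (λ a b a′ b′ u v → (b :- b′) :* v :- (a′ :- a) :* u := (a :* u :+ b :* v) :- (a′ :* u :+ b′ :* v))
                     refl α β α′ β′ u v ⟩
        (α * u + β * v) + - (α′ * u + β′ * v)         ≡⟨ cong (λ x → x + - (α′ * u + β′ * v)) eq ⟩
        (α′ * u + β′ * v) + - (α′ * u + β′ * v)       ≡⟨ -‿inverseʳ _ ⟩
        0#                                           ∎)
      v≡cu : v ≡ c * u
      v≡cu = begin
        v                            ≡⟨ ⁻¹-cancelˡ d≢0 v ⟨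
        d ⁻¹ * (d * v)               ≡⟨ cong (d ⁻¹ *_) dv≡[α′-α]u ⟩
        d ⁻¹ * ((α′ + - α) * u)      ≡⟨ solve 3 (λ i a u → i :* (a :* u) := a :* i :* u) refl (d ⁻¹) (α′ + - α) u ⟩
        c * u                        ∎

    Traceless-combination : ∀ {α β} → Fixed α → Fixed β → Traceless (α * u + β * v)
    Traceless-combination {α} {β} α∈K β∈K = begin
      Tr (α * u + β * v)              ≡⟨ Tr-homo-+ _ _ ⟩
      Tr (α * u) + Tr (β * v)         ≡⟨ cong₂ _+_ (Tr-linear u α∈K) (Tr-linear v β∈K) ⟩
      α * Tr u + β * Tr v             ≡⟨ cong₂ (λ a b → α * a + β * b) u-Traceless v-Traceless ⟩
      α * 0# + β * 0#                 ≡⟨ solve 2 (λ a b → a :* con 0ℤ :+ b :* con 0ℤ := con 0ℤ) refl α β ⟩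
      0#                              ∎

    combine : Fin q → Fin q → Carrier
    combine i j = fixedAt i * u + fixedAt j * v

    plane : List Carrier
    plane = cartesianProductWith combine (allFin q) (allFin q)

    plane! : Unique plane
    plane! = Unique.cartesianProductWith⁺ combine distinct (Unique.allFin⁺ q) (Unique.allFin⁺ q)
      where
      distinct : ∀ {i i′ j j′} → fixedAt i * u + fixedAt j * v ≡ fixedAt i′ * u + fixedAt j′ * v → i ≡ i′ × j ≡ j′
      distinct {i} {i′} {j} {j′} eq = let (αᵢ≡αᵢ′ , βⱼ≡βⱼ′) = coordinates-unique (fixedAt-Fixed i) (fixedAt-Fixed j) (fixedAt-Fixed i′) (fixedAt-Fixed j′) eq
                    in fixedAt-injective αᵢ≡αᵢ′ , fixedAt-injective βⱼ≡βⱼ′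

    plane⇒combination : ∀ {w} → w ∈ plane → Σ[ α ∈ Carrier ] Σ[ β ∈ Carrier ] Fixed α × Fixed β × w ≡ α * u + β * v
    plane⇒combination w∈plane =
      let (i , j , _ , _ , w≡αu+βv) = ∈-cartesianProductWith⁻ combine (allFin q) (allFin q) w∈plane
      in fixedAt i , fixedAt j , fixedAt-Fixed i , fixedAt-Fixed j , w≡αu+βv

    |plane| : length plane ≡ q ℕ.^ 2
    |plane| = trans (length-cartesianProductWith combine (allFin q) (allFin q))
                    (trans (cong₂ ℕ._*_ |allFin| |allFin|) (cong (q ℕ.*_) (sym (ℕ.*-identityʳ q))))
      where
      |allFin| : length (allFin q) ≡ q
      |allFin| = length-tabulate {n = q} id

    Traceless⇒combination : ∀ {w} → Traceless w → Σ[ α ∈ Carrier ] Σ[ β ∈ Carrier ] Fixed α × Fixed β × w ≡ α * u + β * v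
    Traceless⇒combination {w} Trw≡0 = by-cases (w ∈? plane)
      where
      plane⊆W : All Traceless plane
      plane⊆W = All.tabulate (λ w∈plane → let (α , β , α∈K , β∈K , w≡αu+βv) = plane⇒combination w∈plane
                                          in subst Traceless (sym w≡αu+βv) (Traceless-combination α∈K β∈K))
      by-cases : Dec (w ∈ plane) → Σ[ α ∈ Carrier ] Σ[ β ∈ Carrier ] Fixed α × Fixed β × w ≡ α * u + β * v
      by-cases (yes w∈plane) = plane⇒combination w∈plane
      by-cases (no w∉plane)  = contradiction (Traceless-bound (All.¬Any⇒All¬ plane w∉plane ∷ plane!) (Trw≡0 ∷ plane⊆W))
                                             (ℕ.<⇒≱ (ℕ.≤-reflexive (cong suc (sym |plane|))))

  open Basis u-Traceless v-Traceless u≢0 v∉Ku public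

module ProjectivePlane {q} (F : FiniteField q) (q-prime-power : IsPrimePower q) where
  open TracelessBasis F q-prime-power public
  open ≡-Reasoning

  triple-≡ : ∀ {a a′ b b′ c c′} → a ≡ a′ → b ≡ b′ → c ≡ c′ → _≡_ {A = Triple} (a , b , c) (a′ , b′ , c′)
  triple-≡ refl refl refl = refl

  NonZero₁ : ∀ {x y z} → x ≢ 0# → NonZero (x , y , z)
  NonZero₁ x≢0 = x≢0 ∘ cong proj₁

  NonZero₂ : ∀ {x y z} → y ≢ 0# → NonZero (x , y , z)
  NonZero₂ y≢0 = y≢0 ∘ cong (proj₁ ∘ proj₂)

  NonZero⇒₁₂ : ∀ {x y z} → NonZero (x , y , z) → z ≡ 0# → x ≢ 0# ⊎ y ≢ 0#
  NonZero⇒₁₂ {x} {y} nz z≡0 with x ≟ 0# | y ≟ 0#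
  ... | no x≢0  | _        = inj₁ x≢0
  ... | yes _   | no y≢0   = inj₂ y≢0
  ... | yes x≡0 | yes y≡0  = contradiction (triple-≡ x≡0 y≡0 z≡0) nz

  NonZero⇒₁₂₃ : ∀ {x y z} → NonZero (x , y , z) → x ≢ 0# ⊎ y ≢ 0# ⊎ z ≢ 0#
  NonZero⇒₁₂₃ {z = z} nz with z ≟ 0#
  ... | no z≢0  = inj₂ (inj₂ z≢0)
  ... | yes z≡0 with NonZero⇒₁₂ nz z≡0
  ...   | inj₁ x≢0 = inj₁ x≢0
  ...   | inj₂ y≢0 = inj₂ (inj₁ y≢0)

  scale-1# : ∀ P → scale 1# P ≡ P
  scale-1# (x , y , z) = triple-≡ (*-identityˡ x) (*-identityˡ y) (*-identityˡ z)

  scale-* : ∀ c d P → scale c (scale d P) ≡ scale (c * d) P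
  scale-* c d (x , y , z) = triple-≡ (sym (*-assoc c d x)) (sym (*-assoc c d y)) (sym (*-assoc c d z))

  scale-0# : ∀ P → scale 0# P ≡ (0# , 0# , 0#)
  scale-0# (x , y , z) = triple-≡ (zeroˡ x) (zeroˡ y) (zeroˡ z)

  ∼-refl : ∀ {P} → P ∼ P
  ∼-refl {P} = 1# , 1≢0 , sym (scale-1# P)

  ∼-reflexive : ∀ {P Q} → P ≡ Q → P ∼ Q
  ∼-reflexive refl = ∼-refl

  ∼-sym : ∀ {P Q} → P ∼ Q → Q ∼ P
  ∼-sym {P} {Q} (c , c≢0 , P≡cQ) = c ⁻¹ , ⁻¹-≢0 c≢0 , (begin
    Q                        ≡⟨ scale-1# Q ⟨
    scale 1# Q               ≡⟨ cong (λ d → scale d Q) (⁻¹-inverseˡ c≢0) ⟨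
    scale (c ⁻¹ * c) Q       ≡⟨ scale-* (c ⁻¹) c Q ⟨
    scale (c ⁻¹) (scale c Q) ≡⟨ cong (scale (c ⁻¹)) P≡cQ ⟨
    scale (c ⁻¹) P           ∎)

  ∼-trans : ∀ {P Q R} → P ∼ Q → Q ∼ R → P ∼ R
  ∼-trans {R = R} (c , c≢0 , P≡cQ) (d , d≢0 , Q≡dR) = c * d , *-≢0 c≢0 d≢0 , trans P≡cQ (trans (cong (scale c) Q≡dR) (scale-* c d R))

  ≡scale⇒∼ : ∀ {P Q c} → NonZero P → P ≡ scale c Q → P ∼ Q
  ≡scale⇒∼ {Q = Q} {c} P≢0 P≡cQ = c , c≢0 , P≡cQ
    where
    c≢0 : c ≢ 0#
    c≢0 c≡0 = P≢0 (trans P≡cQ (trans (cong (λ d → scale d Q) c≡0) (scale-0# Q)))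

  ∼-NonZero : ∀ {P Q} → P ∼ Q → NonZero Q → NonZero P
  ∼-NonZero {Q = x , y , z} (c , c≢0 , refl) Q≢0 cQ≡0 =
    Q≢0 (triple-≡ (x*y≡0⇒y≡0 c≢0 (cong proj₁ cQ≡0)) (x*y≡0⇒y≡0 c≢0 (cong (proj₁ ∘ proj₂) cQ≡0)) (x*y≡0⇒y≡0 c≢0 (cong (proj₂ ∘ proj₂) cQ≡0)))

  I-scaleʳ : ∀ {ℓ P} c → ℓ I P → ℓ I scale c P
  I-scaleʳ {a , b , d} {x , y , z} c ℓ·P≡0 = begin
    a * (c * x) + b * (c * y) + d * (c * z)    ≡⟨ solve 7 (λ a b d c x y z → a :* (c :* x) :+ b :* (c :* y) :+ d :* (c :* z) := c :* (a :* x :+ b :* y :+ d :* z)) refl a b d c x y z ⟩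
    c * (a * x + b * y + d * z)                ≡⟨ cong (c *_) ℓ·P≡0 ⟩
    c * 0#                                     ≡⟨ zeroʳ c ⟩
    0#                                         ∎

  I-sym : ∀ {ℓ P} → ℓ I P → P I ℓ
  I-sym {a , b , d} {x , y , z} ℓ·P≡0 = trans (solve 6 (λ a b d x y z → x :* a :+ y :* b :+ z :* d := a :* x :+ b :* y :+ d :* z) refl a b d x y z) ℓ·P≡0

  I-respʳ-∼ : ∀ {ℓ P Q} → P ∼ Q → ℓ I Q → ℓ I P
  I-respʳ-∼ (c , _ , refl) = I-scaleʳ c

  I-respˡ-∼ : ∀ {ℓ m P} → ℓ ∼ m → m I P → ℓ I P
  I-respˡ-∼ ℓ∼m = I-sym ∘ I-respʳ-∼ ℓ∼m ∘ I-sym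

  φ-scale : ∀ c P → φ (scale c P) ≡ scale (fr c) (φ P)
  φ-scale c (x , y , z) = triple-≡ (fr-homo-* c z) (fr-homo-* c x) (fr-homo-* c y)

  φ-∼ : ∀ {P Q} → P ∼ Q → φ P ∼ φ Q
  φ-∼ {Q = Q} (c , c≢0 , refl) = fr c , Fr.≢0 c≢0 , φ-scale c Q

  Collinear-resp-∼ : ∀ {P Q} → P ∼ Q → Collinear Q (φ Q) (φ (φ Q)) → Collinear P (φ P) (φ (φ P))
  Collinear-resp-∼ P∼Q (ℓ , ℓ≢0 , ℓIQ , ℓIφQ , ℓIφ²Q) =
    ℓ , ℓ≢0 , I-respʳ-∼ P∼Q ℓIQ , I-respʳ-∼ (φ-∼ P∼Q) ℓIφQ , I-respʳ-∼ (φ-∼ (φ-∼ P∼Q)) ℓIφ²Q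

  TypeIPt-resp-∼ : ∀ {P Q} → P ∼ Q → TypeIPt P → TypeIPt Q
  TypeIPt-resp-∼ P∼Q φP∼P = ∼-trans (φ-∼ (∼-sym P∼Q)) (∼-trans φP∼P P∼Q)

  TypeIIPt-resp-∼ : ∀ {P Q} → P ∼ Q → TypeIIPt Q → TypeIIPt P
  TypeIIPt-resp-∼ P∼Q (¬TypeI , collinear) = ¬TypeI ∘ TypeIPt-resp-∼ P∼Q , Collinear-resp-∼ P∼Q collinear

  TypeIIIPt-resp-∼ : ∀ {P Q} → P ∼ Q → TypeIIIPt Q → TypeIIIPt P
  TypeIIIPt-resp-∼ P∼Q ¬collinear = ¬collinear ∘ Collinear-resp-∼ (∼-sym P∼Q)

  -- Points and lines have the same coordinates, incidence and φ, so line types are point types.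
  TypeIIPt⇒TypeIILine : ∀ {ℓ} → TypeIIPt ℓ → TypeIILine ℓ
  TypeIIPt⇒TypeIILine (¬TypeI , (P , P≢0 , PIℓ , PIφℓ , PIφ²ℓ)) = ¬TypeI , (P , P≢0 , I-sym PIℓ , I-sym PIφℓ , I-sym PIφ²ℓ)

  TypeIIIPt⇒TypeIIILine : ∀ {ℓ} → TypeIIIPt ℓ → TypeIIILine ℓ
  TypeIIIPt⇒TypeIIILine ¬collinear (P , P≢0 , ℓIP , φℓIP , φ²ℓIP) = ¬collinear (P , P≢0 , I-sym ℓIP , I-sym φℓIP , I-sym φ²ℓIP)

  I-T : ∀ {a b} → (a , b , 0#) I T
  I-T {a} {b} = solve 2 (λ a b → a :* con 0ℤ :+ b :* con 0ℤ :+ con 0ℤ :* con 1ℤ := con 0ℤ) refl a b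

  I-T⇒ : ∀ {a b c} → (a , b , c) I T → c ≡ 0#
  I-T⇒ {a} {b} {c} ℓIT = trans (solve 3 (λ a b c → c := a :* con 0ℤ :+ b :* con 0ℤ :+ c :* con 1ℤ) refl a b c) ℓIT

  mT-I : ∀ {x y} → mT I (x , y , 0#)
  mT-I = I-sym I-T

  mT-I⇒ : ∀ {x y z} → mT I (x , y , z) → z ≡ 0#
  mT-I⇒ = I-T⇒ ∘ I-sym

  I⇒₁₂ : ∀ {a b c x y z} → c ≡ 0# ⊎ z ≡ 0# → (a , b , c) I (x , y , z) → a * x + b * y ≡ 0#
  I⇒₁₂ {a} {b} {c} {x} {y} {z} c≡0⊎z≡0 ℓIP = trans (sym (trans (cong (a * x + b * y +_) (cz≡0 c≡0⊎z≡0)) (+-identityʳ _))) ℓIP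
    where
    cz≡0 : c ≡ 0# ⊎ z ≡ 0# → c * z ≡ 0#
    cz≡0 (inj₁ refl) = zeroˡ z
    cz≡0 (inj₂ refl) = zeroʳ c

  ₁₂⇒I : ∀ {a b c x y} → a * x + b * y ≡ 0# → (a , b , c) I (x , y , 0#)
  ₁₂⇒I {a} {b} {c} {x} {y} eq = trans (cong (a * x + b * y +_) (zeroʳ c)) (trans (+-identityʳ _) eq)

  -- the point of m_T on a line [a, b, c] other than m_T
  at-infinity : ∀ {a b r₁ r₂ r₃} → a ≢ 0# ⊎ b ≢ 0# → r₃ ≡ 0# → NonZero (r₁ , r₂ , r₃) →
                a * r₁ + b * r₂ ≡ 0# → (r₁ , r₂ , r₃) ∼ (b , - a , 0#)
  at-infinity {a} {b} {r₁} {r₂} (inj₁ a≢0) refl R≢0 eq = ≡scale⇒∼ R≢0 (triple-≡ r₁≡cb r₂≡c[-a] (sym (zeroʳ c)))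
    where
    c = - (r₂ * a ⁻¹)
    r₁≡cb : r₁ ≡ c * b
    r₁≡cb = begin
      r₁                   ≡⟨ ⁻¹-cancelˡ a≢0 r₁ ⟨
      a ⁻¹ * (a * r₁)      ≡⟨ cong (a ⁻¹ *_) (x+y≡0⇒x≡-y eq) ⟩
      a ⁻¹ * - (b * r₂)    ≡⟨ solve 3 (λ i b r → i :* (:- (b :* r)) := (:- (r :* i)) :* b) refl (a ⁻¹) b r₂ ⟩
      c * b                ∎
    r₂≡c[-a] : r₂ ≡ c * - a
    r₂≡c[-a] = begin
      r₂                   ≡⟨ *-identityʳ r₂ ⟨
      r₂ * 1#              ≡⟨ cong (r₂ *_) (⁻¹-inverseˡ a≢0) ⟨
      r₂ * (a ⁻¹ * a)      ≡⟨ solve 3 (λ r i a → r :* (i :* a) := (:- (r :* i)) :* (:- a)) refl r₂ (a ⁻¹) a ⟩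
      c * - a              ∎
  at-infinity {a} {b} {r₁} {r₂} (inj₂ b≢0) refl R≢0 eq = ≡scale⇒∼ R≢0 (triple-≡ r₁≡cb r₂≡c[-a] (sym (zeroʳ c)))
    where
    c = r₁ * b ⁻¹
    r₁≡cb : r₁ ≡ c * b
    r₁≡cb = begin
      r₁                   ≡⟨ *-identityʳ r₁ ⟨
      r₁ * 1#              ≡⟨ cong (r₁ *_) (⁻¹-inverseˡ b≢0) ⟨
      r₁ * (b ⁻¹ * b)      ≡⟨ *-assoc r₁ (b ⁻¹) b ⟨
      c * b                ∎
    r₂≡c[-a] : r₂ ≡ c * - a
    r₂≡c[-a] = begin
      r₂                   ≡⟨ ⁻¹-cancelˡ b≢0 r₂ ⟨
      b ⁻¹ * (b * r₂)      ≡⟨ cong (b ⁻¹ *_) (x+y≡0⇒x≡-y (trans (+-comm _ _) eq)) ⟩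
      b ⁻¹ * - (a * r₁)    ≡⟨ solve 3 (λ i a r → i :* (:- (a :* r)) := (r :* i) :* (:- a)) refl (b ⁻¹) a r₁ ⟩
      c * - a              ∎

module PointsOfS {q} (F : FiniteField q) (q-prime-power : IsPrimePower q) where
  open ProjectivePlane F q-prime-power public
  open ≡-Reasoning

  S-resp-∼ : ∀ {θ P Q} → P ∼ Q → S θ Q → S θ P
  S-resp-∼ P∼Q (x , x≢0 , Q∼) = x , x≢0 , ∼-trans P∼Q Q∼

  S-intro : ∀ θ {a} → a ≢ 0# → S θ (fr a * θ , a , 0#)
  S-intro θ {a} a≢0 = a ⁻¹ , ⁻¹-≢0 a≢0 , ≡scale⇒∼ (NonZero₂ a≢0) (triple-≡ first second (sym (zeroʳ _)))
    where
    first : fr a * θ ≡ (a * fr a) * (a ⁻¹ * θ)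
    first = begin
      fr a * θ                      ≡⟨ *-identityˡ _ ⟨
      1# * (fr a * θ)               ≡⟨ cong (_* (fr a * θ)) (⁻¹-inverseʳ a≢0) ⟨
      a * a ⁻¹ * (fr a * θ)         ≡⟨ solve 4 (λ a i f t → a :* i :* (f :* t) := a :* f :* (i :* t)) refl a (a ⁻¹) (fr a) θ ⟩
      (a * fr a) * (a ⁻¹ * θ)       ∎
    second : a ≡ (a * fr a) * fr (a ⁻¹)
    second = begin
      a                             ≡⟨ *-identityʳ a ⟨
      a * 1#                        ≡⟨ cong (a *_) (Fr.*⁻¹-homo a≢0) ⟨
      a * (fr a * fr (a ⁻¹))        ≡⟨ *-assoc a (fr a) _ ⟨
      (a * fr a) * fr (a ⁻¹)        ∎

  S-elim : ∀ {θ R} → S θ R → Σ[ a ∈ Carrier ] a ≢ 0# × R ∼ (fr a * θ , a , 0#)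
  S-elim {θ} (x , x≢0 , R∼) = x ⁻¹ , ⁻¹-≢0 x≢0 , ∼-trans R∼ (≡scale⇒∼ (NonZero₂ (Fr.≢0 x≢0)) (triple-≡ first second (sym (zeroʳ c))))
    where
    c = x * fr x
    first : x * θ ≡ c * (fr (x ⁻¹) * θ)
    first = begin
      x * θ                           ≡⟨ cong (λ y → y * θ) (*-identityʳ x) ⟨
      x * 1# * θ                      ≡⟨ cong (λ y → x * y * θ) (Fr.*⁻¹-homo x≢0) ⟨
      x * (fr x * fr (x ⁻¹)) * θ      ≡⟨ solve 4 (λ x X i θ → x :* (X :* i) :* θ := x :* X :* (i :* θ)) refl x (fr x) (fr (x ⁻¹)) θ ⟩
      c * (fr (x ⁻¹) * θ)             ∎
    second : fr x ≡ c * x ⁻¹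
    second = begin
      fr x                   ≡⟨ *-identityˡ (fr x) ⟨
      1# * fr x              ≡⟨ cong (_* fr x) (⁻¹-inverseʳ x≢0) ⟨
      x * x ⁻¹ * fr x        ≡⟨ solve 3 (λ x i X → x :* i :* X := x :* X :* i) refl x (x ⁻¹) (fr x) ⟩
      c * x ⁻¹               ∎

  module Representative {θ} (θ∈K : Fixed θ) (x : Carrier) where

    P : Triple
    P = (x * θ , fr x , 0#)

    φP≡ : φ P ≡ (0# , fr x * θ , fr2 x)
    φP≡ = triple-≡ Fr.0#-homo (trans (fr-homo-* x θ) (cong (fr x *_) θ∈K)) (fr∘fr≡fr2 x)

    φ²P≡ : φ (φ P) ≡ (x , 0# , fr2 x * θ)
    φ²P≡ = trans (cong φ φP≡) (triple-≡ (fr∘fr2≡id x) Fr.0#-homo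
                                        (trans (fr-homo-* (fr x) θ) (cong₂ _*_ (fr∘fr≡fr2 x) θ∈K)))

    ¬TypeIPt : x ≢ 0# → θ ≢ 0# → ¬ TypeIPt P
    ¬TypeIPt x≢0 θ≢0 (c , c≢0 , φP≡cP) = *-≢0 x≢0 θ≢0 (x*y≡0⇒y≡0 c≢0 (trans (sym (cong proj₁ φP≡cP)) Fr.0#-homo))

    collinear : θ * θ * θ + 1# ≡ 0# → x ≢ 0# → Collinear P (φ P) (φ (φ P))
    collinear θ³+1≡0 x≢0 = ℓ , NonZero₁ (*-≢0 (Fr.≢0 x≢0) (Fr2.≢0 x≢0)) , ℓIP , subst (ℓ I_) (sym φP≡) ℓIφP , subst (ℓ I_) (sym φ²P≡) ℓIφ²P
      where
      X = fr x
      Y = fr2 x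
      ℓ = (X * Y , - (x * Y * θ) , x * X * (θ * θ))
      ℓIP : ℓ I P
      ℓIP = solve 4 (λ x X Y θ → X :* Y :* (x :* θ) :+ (:- (x :* Y :* θ)) :* X :+ x :* X :* (θ :* θ) :* con 0ℤ := con 0ℤ) refl x X Y θ
      ℓIφP : ℓ I (0# , X * θ , Y)
      ℓIφP = solve 4 (λ x X Y θ → X :* Y :* con 0ℤ :+ (:- (x :* Y :* θ)) :* (X :* θ) :+ x :* X :* (θ :* θ) :* Y := con 0ℤ) refl x X Y θ
      ℓIφ²P : ℓ I (x , 0# , Y * θ)
      ℓIφ²P = begin
        X * Y * x + - (x * Y * θ) * 0# + x * X * (θ * θ) * (Y * θ)
          ≡⟨ solve 4 (λ x X Y θ → X :* Y :* x :+ (:- (x :* Y :* θ)) :* con 0ℤ :+ x :* X :* (θ :* θ) :* (Y :* θ)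
                                  := x :* X :* Y :* (θ :* θ :* θ :+ con 1ℤ)) refl x X Y θ ⟩
        x * X * Y * (θ * θ * θ + 1#)                                ≡⟨ cong (x * X * Y *_) θ³+1≡0 ⟩
        x * X * Y * 0#                                              ≡⟨ zeroʳ _ ⟩
        0#                                                          ∎

    ¬collinear : θ * θ * θ + 1# ≢ 0# → x ≢ 0# → ¬ Collinear P (φ P) (φ (φ P))
    ¬collinear θ³+1≢0 x≢0 ((l₁ , l₂ , l₃) , ℓ≢0 , ℓIP , ℓIφP , ℓIφ²P) = ℓ≢0 (triple-≡ l₁≡0 l₂≡0 l₃≡0)
      where
      X = fr x
      Y = fr2 x
      E₁ = l₁ * (x * θ) + l₂ * X + l₃ * 0#
      E₂ = l₁ * 0# + l₂ * (X * θ) + l₃ * Y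
      E₃ = l₁ * x + l₂ * 0# + l₃ * (Y * θ)
      e₁ : E₁ ≡ 0#
      e₁ = ℓIP
      e₂ : E₂ ≡ 0#
      e₂ = subst ((l₁ , l₂ , l₃) I_) φP≡ ℓIφP
      e₃ : E₃ ≡ 0#
      e₃ = subst ((l₁ , l₂ , l₃) I_) φ²P≡ ℓIφ²P
      -- E₁ + θ²E₂ - θE₃ eliminates l₁ and l₃
      l₂X[θ³+1]≡0 : l₂ * X * (θ * θ * θ + 1#) ≡ 0#
      l₂X[θ³+1]≡0 = begin
        l₂ * X * (θ * θ * θ + 1#)
          ≡⟨ solve 7 (λ l₁ l₂ l₃ x X Y θ → l₂ :* X :* (θ :* θ :* θ :+ con 1ℤ)
                                          := (l₁ :* (x :* θ) :+ l₂ :* X :+ l₃ :* con 0ℤ)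
                                             :+ θ :* θ :* (l₁ :* con 0ℤ :+ l₂ :* (X :* θ) :+ l₃ :* Y)
                                             :- θ :* (l₁ :* x :+ l₂ :* con 0ℤ :+ l₃ :* (Y :* θ)))
                     refl l₁ l₂ l₃ x X Y θ ⟩
        E₁ + θ * θ * E₂ + - (θ * E₃)    ≡⟨ cong₂ (λ a b → a + θ * θ * b + - (θ * E₃)) e₁ e₂ ⟩
        0# + θ * θ * 0# + - (θ * E₃)    ≡⟨ cong (λ c → 0# + θ * θ * 0# + - (θ * c)) e₃ ⟩
        0# + θ * θ * 0# + - (θ * 0#)    ≡⟨ solve 1 (λ θ → con 0ℤ :+ θ :* θ :* con 0ℤ :- θ :* con 0ℤ := con 0ℤ) refl θ ⟩
        0#                              ∎
      l₂≡0 : l₂ ≡ 0#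
      l₂≡0 = x*y≡0⇒x≡0 (Fr.≢0 x≢0) (x*y≡0⇒x≡0 θ³+1≢0 l₂X[θ³+1]≡0)
      l₃≡0 : l₃ ≡ 0#
      l₃≡0 = x*y≡0⇒x≡0 (Fr2.≢0 x≢0) (trans (solve 5 (λ l₁ l₃ X Y θ → l₃ :* Y := l₁ :* con 0ℤ :+ con 0ℤ :* (X :* θ) :+ l₃ :* Y) refl l₁ l₃ X Y θ)
                                           (subst (λ l → l₁ * 0# + l * (X * θ) + l₃ * Y ≡ 0#) l₂≡0 e₂))
      l₁≡0 : l₁ ≡ 0#
      l₁≡0 = x*y≡0⇒x≡0 x≢0 (trans (solve 4 (λ l₁ x Y θ → l₁ :* x := l₁ :* x :+ con 0ℤ :* con 0ℤ :+ con 0ℤ :* (Y :* θ)) refl l₁ x Y θ)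
                                   (subst₂ (λ l l′ → l₁ * x + l * 0# + l′ * (Y * θ) ≡ 0#) l₂≡0 l₃≡0 e₃))

  S-TypeIIPt : ∀ {θ} → Fixed θ → θ ≢ 0# → θ * θ * θ + 1# ≡ 0# → ∀ P → S θ P → TypeIIPt P
  S-TypeIIPt θ∈K θ≢0 θ³+1≡0 _ (x , x≢0 , P∼) = TypeIIPt-resp-∼ P∼ (¬TypeIPt x≢0 θ≢0 , collinear θ³+1≡0 x≢0)
    where open Representative θ∈K x

  S-TypeIIIPt : ∀ {θ} → Fixed θ → θ * θ * θ + 1# ≢ 0# → ∀ P → S θ P → TypeIIIPt P
  S-TypeIIIPt θ∈K θ³+1≢0 _ (x , x≢0 , P∼) = TypeIIIPt-resp-∼ P∼ (¬collinear θ³+1≢0 x≢0)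
    where open Representative θ∈K x

  -- The line joining T to a point of S θ has the coordinates of a point of S (- θ).
  TS⇒S : ∀ {θ} → Fixed θ → θ * θ ≡ 1# → ∀ {ℓ} → TS θ ℓ → S (- θ) ℓ
  TS⇒S {θ} θ∈K θ²≡1 {l₁ , l₂ , l₃} (ℓ≢0 , X , (x , x≢0 , X∼) , ℓIT , ℓIX) =
    S-resp-∼ (∼-trans ℓ∼ (∼-reflexive (triple-≡ (sym first) refl refl))) (S-intro (- θ) (-‿≢0 (*-≢0 x≢0 θ≢0)))
    where
    θ≢0 : θ ≢ 0#
    θ≢0 θ≡0 = 1≢0 (trans (sym θ²≡1) (trans (cong (_* θ) θ≡0) (zeroˡ θ)))
    ℓ∼ : (l₁ , l₂ , l₃) ∼ (fr x , - (x * θ) , 0#)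
    ℓ∼ = at-infinity (inj₁ (*-≢0 x≢0 θ≢0)) (I-T⇒ ℓIT) ℓ≢0
           (trans (cong₂ _+_ (*-comm (x * θ) l₁) (*-comm (fr x) l₂)) (I⇒₁₂ (inj₂ refl) (I-respʳ-∼ (∼-sym X∼) ℓIX)))
    first : fr (- (x * θ)) * - θ ≡ fr x
    first = begin
      fr (- (x * θ)) * - θ         ≡⟨ cong (_* - θ) (trans (Fr.-‿homo (x * θ)) (cong -_ (trans (fr-homo-* x θ) (cong (fr x *_) θ∈K)))) ⟩
      - (fr x * θ) * - θ           ≡⟨ solve 2 (λ X θ → (:- (X :* θ)) :* (:- θ) := X :* (θ :* θ)) refl (fr x) θ ⟩
      fr x * (θ * θ)               ≡⟨ cong (fr x *_) θ²≡1 ⟩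
      fr x * 1#                    ≡⟨ *-identityʳ (fr x) ⟩
      fr x                         ∎

module LinesOfSubplanes {q} (F : FiniteField q) (q-prime-power : IsPrimePower q) where
  open PointsOfS F q-prime-power public
  open ≡-Reasoning

  cross : Triple → Triple → Triple
  cross (x₁ , x₂ , x₃) (y₁ , y₂ , y₃) = (x₂ * y₃ + - (x₃ * y₂) , x₃ * y₁ + - (x₁ * y₃) , x₁ * y₂ + - (x₂ * y₁))

  cross≡0⇒≡scale : ∀ {U V} → NonZero V → cross U V ≡ (0# , 0# , 0#) → Σ[ c ∈ Carrier ] U ≡ scale c V
  cross≡0⇒≡scale {u₁ , u₂ , u₃} {v₁ , v₂ , v₃} V≢0 U×V≡0 = by-cases (NonZero⇒₁₂₃ V≢0)
    where
    c₁ : u₂ * v₃ ≡ u₃ * v₂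
    c₁ = x-y≡0⇒x≡y (cong proj₁ U×V≡0)
    c₂ : u₃ * v₁ ≡ u₁ * v₃
    c₂ = x-y≡0⇒x≡y (cong (proj₁ ∘ proj₂) U×V≡0)
    c₃ : u₁ * v₂ ≡ u₂ * v₁
    c₃ = x-y≡0⇒x≡y (cong (proj₂ ∘ proj₂) U×V≡0)
    proportional : ∀ {uᵢ vᵢ uⱼ vⱼ} → vᵢ ≢ 0# → uⱼ * vᵢ ≡ uᵢ * vⱼ → uⱼ ≡ uᵢ * vᵢ ⁻¹ * vⱼ
    proportional {uᵢ} {vᵢ} {uⱼ} {vⱼ} vᵢ≢0 eq = begin
      uⱼ                      ≡⟨ *-identityʳ uⱼ ⟨
      uⱼ * 1#                 ≡⟨ cong (uⱼ *_) (⁻¹-inverseʳ vᵢ≢0) ⟨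
      uⱼ * (vᵢ * vᵢ ⁻¹)       ≡⟨ *-assoc uⱼ vᵢ (vᵢ ⁻¹) ⟨
      uⱼ * vᵢ * vᵢ ⁻¹         ≡⟨ cong (_* vᵢ ⁻¹) eq ⟩
      uᵢ * vⱼ * vᵢ ⁻¹         ≡⟨ solve 3 (λ a b c → a :* b :* c := a :* c :* b) refl uᵢ vⱼ (vᵢ ⁻¹) ⟩
      uᵢ * vᵢ ⁻¹ * vⱼ         ∎
    by-cases : v₁ ≢ 0# ⊎ v₂ ≢ 0# ⊎ v₃ ≢ 0# → Σ[ c ∈ Carrier ] (u₁ , u₂ , u₃) ≡ scale c (v₁ , v₂ , v₃)
    by-cases (inj₁ v₁≢0)        = u₁ * v₁ ⁻¹ , triple-≡ (proportional v₁≢0 refl) (proportional v₁≢0 (sym c₃)) (proportional v₁≢0 c₂)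
    by-cases (inj₂ (inj₁ v₂≢0)) = u₂ * v₂ ⁻¹ , triple-≡ (proportional v₂≢0 c₃) (proportional v₂≢0 refl) (proportional v₂≢0 (sym c₁))
    by-cases (inj₂ (inj₂ v₃≢0)) = u₃ * v₃ ⁻¹ , triple-≡ (proportional v₃≢0 (sym c₂)) (proportional v₃≢0 c₁) (proportional v₃≢0 refl)

  private
    -- first coordinate of the identity L × (P × Q) = (L·Q) P - (L·P) Q
    cross-cross₁ : ∀ {l₁ l₂ l₃ x₁ x₂ x₃ y₁ y₂ y₃} → l₁ * x₁ + l₂ * x₂ + l₃ * x₃ ≡ 0# → l₁ * y₁ + l₂ * y₂ + l₃ * y₃ ≡ 0# →
                   l₂ * (x₁ * y₂ + - (x₂ * y₁)) + - (l₃ * (x₃ * y₁ + - (x₁ * y₃))) ≡ 0#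
    cross-cross₁ {l₁} {l₂} {l₃} {x₁} {x₂} {x₃} {y₁} {y₂} {y₃} L·P≡0 L·Q≡0 = begin
      l₂ * (x₁ * y₂ + - (x₂ * y₁)) + - (l₃ * (x₃ * y₁ + - (x₁ * y₃)))
        ≡⟨ solve 9 (λ l₁ l₂ l₃ x₁ x₂ x₃ y₁ y₂ y₃ → l₂ :* (x₁ :* y₂ :- x₂ :* y₁) :- l₃ :* (x₃ :* y₁ :- x₁ :* y₃)
                                                   := x₁ :* (l₁ :* y₁ :+ l₂ :* y₂ :+ l₃ :* y₃) :- y₁ :* (l₁ :* x₁ :+ l₂ :* x₂ :+ l₃ :* x₃))
                   refl l₁ l₂ l₃ x₁ x₂ x₃ y₁ y₂ y₃ ⟩
      x₁ * (l₁ * y₁ + l₂ * y₂ + l₃ * y₃) + - (y₁ * (l₁ * x₁ + l₂ * x₂ + l₃ * x₃))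
        ≡⟨ cong₂ (λ a b → x₁ * a + - (y₁ * b)) L·Q≡0 L·P≡0 ⟩
      x₁ * 0# + - (y₁ * 0#)
        ≡⟨ solve 2 (λ x y → x :* con 0ℤ :- y :* con 0ℤ := con 0ℤ) refl x₁ y₁ ⟩
      0# ∎

    rotate : ∀ {a b c} → a + b + c ≡ 0# → b + c + a ≡ 0#
    rotate {a} {b} {c} eq = trans (solve 3 (λ a b c → b :+ c :+ a := a :+ b :+ c) refl a b c) eq

  cross-cross≡0 : ∀ {L P Q} → L I P → L I Q → cross L (cross P Q) ≡ (0# , 0# , 0#)
  cross-cross≡0 L·P≡0 L·Q≡0 = triple-≡ (cross-cross₁ L·P≡0 L·Q≡0)
                                       (cross-cross₁ (rotate L·P≡0) (rotate L·Q≡0))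
                                       (cross-cross₁ (rotate (rotate L·P≡0)) (rotate (rotate L·Q≡0)))

  line-through : ∀ {ℓ P Q} → NonZero ℓ → NonZero P → NonZero Q → ¬ P ∼ Q → ℓ I P → ℓ I Q → NonZero (cross P Q) × ℓ ∼ cross P Q
  line-through ℓ≢0 P≢0 Q≢0 P≁Q ℓIP ℓIQ = P×Q≢0 , ≡scale⇒∼ ℓ≢0 (proj₂ (cross≡0⇒≡scale P×Q≢0 (cross-cross≡0 ℓIP ℓIQ)))
    where
    P×Q≢0 : NonZero (cross _ _)
    P×Q≢0 P×Q≡0 = P≁Q (≡scale⇒∼ P≢0 (proj₂ (cross≡0⇒≡scale Q≢0 P×Q≡0)))

  emb : Carrier → Triple
  emb x = (x , fr x , fr2 x)

  emb-NonZero : ∀ {x} → x ≢ 0# → NonZero (emb x)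
  emb-NonZero = NonZero₁

  emb-NonZero⁻ : ∀ {x} → NonZero (emb x) → x ≢ 0#
  emb-NonZero⁻ emb≢0 refl = emb≢0 (triple-≡ refl Fr.0#-homo Fr2.0#-homo)

  cross-emb : ∀ x y → cross (emb x) (emb y) ≡ emb (fr x * fr2 y + - (fr2 x * fr y))
  cross-emb x y = triple-≡ refl (sym second) (sym third)
    where
    second : fr (fr x * fr2 y + - (fr2 x * fr y)) ≡ fr2 x * y + - (x * fr2 y)
    second = begin
      fr (fr x * fr2 y + - (fr2 x * fr y))                  ≡⟨ trans (fr-homo-+ _ _) (cong₂ _+_ (fr-homo-* _ _) (trans (Fr.-‿homo _) (cong -_ (fr-homo-* _ _)))) ⟩
      fr (fr x) * fr (fr2 y) + - (fr (fr2 x) * fr (fr y))  ≡⟨ cong₂ (λ a b → a * fr (fr2 y) + - (fr (fr2 x) * b)) (fr∘fr≡fr2 x) (fr∘fr≡fr2 y) ⟩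
      fr2 x * fr (fr2 y) + - (fr (fr2 x) * fr2 y)          ≡⟨ cong₂ (λ a b → fr2 x * a + - (b * fr2 y)) (fr∘fr2≡id y) (fr∘fr2≡id x) ⟩
      fr2 x * y + - (x * fr2 y)                            ∎
    third : fr2 (fr x * fr2 y + - (fr2 x * fr y)) ≡ x * fr y + - (fr x * y)
    third = begin
      fr2 (fr x * fr2 y + - (fr2 x * fr y))                    ≡⟨ trans (fr2-homo-+ _ _) (cong₂ _+_ (fr2-homo-* _ _) (trans (Fr2.-‿homo _) (cong -_ (fr2-homo-* _ _)))) ⟩
      fr2 (fr x) * fr2 (fr2 y) + - (fr2 (fr2 x) * fr2 (fr y))  ≡⟨ cong₂ (λ a b → a * fr2 (fr2 y) + - (fr2 (fr2 x) * b)) (fr2∘fr≡id x) (fr2∘fr≡id y) ⟩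
      x * fr2 (fr2 y) + - (fr2 (fr2 x) * y)                    ≡⟨ cong₂ (λ a b → x * a + - (b * y)) (fr2∘fr2≡fr y) (fr2∘fr2≡fr x) ⟩
      x * fr y + - (fr x * y)                                  ∎

  emb-scale : ∀ {α} y → Fixed α → emb (α * y) ≡ scale α (emb y)
  emb-scale {α} y α∈K = triple-≡ refl (trans (fr-homo-* α y) (cong (_* fr y) α∈K)) (trans (fr2-homo-* α y) (cong (_* fr2 y) (fr2-Fixed α∈K)))

  emb-∼⇒ : ∀ {x y} → y ≢ 0# → emb x ∼ emb y → Σ[ c ∈ Carrier ] c ≢ 0# × Fixed c × x ≡ c * y
  emb-∼⇒ {x} {y} y≢0 (c , c≢0 , x≡cy) = c , c≢0 , c∈K , cong proj₁ x≡cy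
    where
    c∈K : Fixed c
    c∈K = *-cancelˡ (Fr.≢0 y≢0) (begin
      fr y * fr c        ≡⟨ *-comm (fr y) (fr c) ⟩
      fr c * fr y        ≡⟨ fr-homo-* c y ⟨
      fr (c * y)         ≡⟨ cong fr (cong proj₁ x≡cy) ⟨
      fr x               ≡⟨ cong (proj₁ ∘ proj₂) x≡cy ⟩
      c * fr y           ≡⟨ *-comm c (fr y) ⟩
      fr y * c           ∎)

  emb·emb≡Tr : ∀ a x → a * x + fr a * fr x + fr2 a * fr2 x ≡ Tr (a * x)
  emb·emb≡Tr a x = sym (cong₂ (λ s t → a * x + s + t) (fr-homo-* a x) (fr2-homo-* a x))

  P2q-line⇒ : ∀ {ℓ} → LineOf P2q ℓ → Σ[ a ∈ Carrier ] a ≢ 0# × ℓ ∼ emb a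
  P2q-line⇒ {ℓ} (ℓ≢0 , f , f-on-ℓ , f-injective , _) =
    a , emb-NonZero⁻ (subst NonZero (cross-emb x y) x×y≢0) , subst (ℓ ∼_) (cross-emb x y) ℓ∼x×y
    where
    one : Fin (suc q)
    one = Fin.fromℕ< (s≤s (ℕ.≤-trans (s≤s z≤n) 2≤q))
    x = proj₁ (proj₁ (f-on-ℓ Fin.zero))
    x≢0 = proj₁ (proj₂ (proj₁ (f-on-ℓ Fin.zero)))
    f₀∼x = proj₂ (proj₂ (proj₁ (f-on-ℓ Fin.zero)))
    y = proj₁ (proj₁ (f-on-ℓ one))
    y≢0 = proj₁ (proj₂ (proj₁ (f-on-ℓ one)))
    f₁∼y = proj₂ (proj₂ (proj₁ (f-on-ℓ one)))
    a = fr x * fr2 y + - (fr2 x * fr y)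
    x≁y : ¬ emb x ∼ emb y
    x≁y x∼y = zero≢one (cong Fin.toℕ (f-injective Fin.zero one (∼-trans f₀∼x (∼-trans x∼y (∼-sym f₁∼y)))))
      where zero≢one : 0 ≢ Fin.toℕ one
            zero≢one ()
    x×y≢0,ℓ∼x×y = line-through ℓ≢0 (emb-NonZero x≢0) (emb-NonZero y≢0) x≁y
                                (I-respʳ-∼ (∼-sym f₀∼x) (proj₂ (f-on-ℓ Fin.zero))) (I-respʳ-∼ (∼-sym f₁∼y) (proj₂ (f-on-ℓ one)))
    x×y≢0 = proj₁ x×y≢0,ℓ∼x×y
    ℓ∼x×y = proj₂ x×y≢0,ℓ∼x×y

  -- representatives of the q + 1 one-dimensional F_q-subspaces of the traceless elements
  basisPoint : Fin (suc q) → Carrier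
  basisPoint Fin.zero    = u
  basisPoint (Fin.suc i) = fixedAt i * u + v

  basisPoint-Traceless : ∀ i → Traceless (basisPoint i)
  basisPoint-Traceless Fin.zero    = u-Traceless
  basisPoint-Traceless (Fin.suc i) = subst Traceless (cong (fixedAt i * u +_) (*-identityˡ v)) (Traceless-combination (fixedAt-Fixed i) Fixed-1#)

  basisPoint-≢0 : ∀ i → basisPoint i ≢ 0#
  basisPoint-≢0 Fin.zero    = u≢0
  basisPoint-≢0 (Fin.suc i) tu+v≡0 = v∉Ku (Fixed-neg (fixedAt-Fixed i)) (begin
    v                                  ≡⟨ solve 3 (λ v t u → v := (:- t) :* u :+ (t :* u :+ v)) refl v (fixedAt i) u ⟩
    - fixedAt i * u + (fixedAt i * u + v) ≡⟨ cong (- fixedAt i * u +_) tu+v≡0 ⟩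
    - fixedAt i * u + 0#               ≡⟨ +-identityʳ _ ⟩
    - fixedAt i * u                    ∎)

  basisPoint-injective : ∀ i j {c} → Fixed c → basisPoint i ≡ c * basisPoint j → i ≡ j
  basisPoint-injective Fin.zero    Fin.zero    _   _  = refl
  basisPoint-injective Fin.zero    (Fin.suc j) {c} c∈K eq = contradiction 1≡0 1≢0
    where
    coordinates = coordinates-unique Fixed-1# Fixed-0# (Fixed-* c∈K (fixedAt-Fixed j)) c∈K (begin
      1# * u + 0# * v                  ≡⟨ solve 2 (λ u v → con 1ℤ :* u :+ con 0ℤ :* v := u) refl u v ⟩
      u                                ≡⟨ eq ⟩
      c * (fixedAt j * u + v)          ≡⟨ solve 4 (λ c t u v → c :* (t :* u :+ v) := c :* t :* u :+ c :* v) refl c (fixedAt j) u v ⟩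
      c * fixedAt j * u + c * v        ∎)
    1≡0 : 1# ≡ 0#
    1≡0 = trans (proj₁ coordinates) (trans (cong (_* fixedAt j) (sym (proj₂ coordinates))) (zeroˡ _))
  basisPoint-injective (Fin.suc i) Fin.zero    {c} c∈K eq = contradiction (proj₂ coordinates) 1≢0
    where
    coordinates = coordinates-unique (fixedAt-Fixed i) Fixed-1# c∈K Fixed-0# (begin
      fixedAt i * u + 1# * v           ≡⟨ cong (fixedAt i * u +_) (*-identityˡ v) ⟩
      fixedAt i * u + v                ≡⟨ eq ⟩
      c * u                            ≡⟨ solve 3 (λ c u v → c :* u := c :* u :+ con 0ℤ :* v) refl c u v ⟩
      c * u + 0# * v                   ∎)
  basisPoint-injective (Fin.suc i) (Fin.suc j) {c} c∈K eq =
    cong Fin.suc (fixedAt-injective (trans (proj₁ coordinates) (trans (cong (_* fixedAt j) (sym (proj₂ coordinates))) (*-identityˡ _))))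
    where
    coordinates = coordinates-unique (fixedAt-Fixed i) Fixed-1# (Fixed-* c∈K (fixedAt-Fixed j)) c∈K (begin
      fixedAt i * u + 1# * v           ≡⟨ cong (fixedAt i * u +_) (*-identityˡ v) ⟩
      fixedAt i * u + v                ≡⟨ eq ⟩
      c * (fixedAt j * u + v)          ≡⟨ solve 4 (λ c t u v → c :* (t :* u :+ v) := c :* t :* u :+ c :* v) refl c (fixedAt j) u v ⟩
      c * fixedAt j * u + c * v        ∎)

  basisPoint-surjective : ∀ {w} → Traceless w → Σ[ i ∈ Fin (suc q) ] Σ[ c ∈ Carrier ] Fixed c × w ≡ c * basisPoint i
  basisPoint-surjective {w} Trw≡0 = by-cases (β ≟ 0#)
    where
    combination = Traceless⇒combination Trw≡0
    α = proj₁ combination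
    β = proj₁ (proj₂ combination)
    α∈K = proj₁ (proj₂ (proj₂ combination))
    β∈K = proj₁ (proj₂ (proj₂ (proj₂ combination)))
    w≡αu+βv = proj₂ (proj₂ (proj₂ (proj₂ combination)))
    by-cases : Dec (β ≡ 0#) → Σ[ i ∈ Fin (suc q) ] Σ[ c ∈ Carrier ] Fixed c × w ≡ c * basisPoint i
    by-cases (yes β≡0) = Fin.zero , α , α∈K , (begin
      w                 ≡⟨ w≡αu+βv ⟩
      α * u + β * v     ≡⟨ cong (λ b → α * u + b * v) β≡0 ⟩
      α * u + 0# * v    ≡⟨ solve 3 (λ a u v → a :* u :+ con 0ℤ :* v := a :* u) refl α u v ⟩
      α * u             ∎)
    by-cases (no β≢0)  = Fin.suc i , β , β∈K , (begin
      w                            ≡⟨ w≡αu+βv ⟩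
      α * u + β * v                ≡⟨ cong (λ a → a * u + β * v) (⁻¹-cancelˡ β≢0 α) ⟨
      β ⁻¹ * (β * α) * u + β * v   ≡⟨ solve 5 (λ i b a u v → i :* (b :* a) :* u :+ b :* v := b :* (i :* a :* u :+ v)) refl (β ⁻¹) β α u v ⟩
      β * (β ⁻¹ * α * u + v)       ≡⟨ cong (λ t → β * (t * u + v)) (sym fixedAtᵢ≡β⁻¹α) ⟩
      β * (fixedAt i * u + v)      ∎)
      where
      i = proj₁ (fixedAt-surjective (Fixed-* (Fixed-⁻¹ β∈K) α∈K))
      fixedAtᵢ≡β⁻¹α = proj₂ (fixedAt-surjective (Fixed-* (Fixed-⁻¹ β∈K) α∈K))

  emb-line : ∀ {a} → a ≢ 0# → LineOf P2q (emb a)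
  emb-line {a} a≢0 = emb-NonZero a≢0 , point , on-line , injective , exhaustive
    where
    point : Fin (suc q) → Triple
    point i = emb (a ⁻¹ * basisPoint i)
    a⁻¹bᵢ≢0 : ∀ i → a ⁻¹ * basisPoint i ≢ 0#
    a⁻¹bᵢ≢0 i = *-≢0 (⁻¹-≢0 a≢0) (basisPoint-≢0 i)
    a*a⁻¹ : ∀ y → a * (a ⁻¹ * y) ≡ y
    a*a⁻¹ y = trans (sym (*-assoc a (a ⁻¹) y)) (trans (cong (_* y) (⁻¹-inverseʳ a≢0)) (*-identityˡ y))
    on-line : ∀ i → P2q (point i) × emb a I point i
    on-line i = (a ⁻¹ * basisPoint i , a⁻¹bᵢ≢0 i , ∼-refl) ,
                trans (emb·emb≡Tr a _) (trans (cong Tr (a*a⁻¹ (basisPoint i))) (basisPoint-Traceless i))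
    injective : ∀ i j → point i ∼ point j → i ≡ j
    injective i j pᵢ∼pⱼ = basisPoint-injective i j c∈K (*-cancelˡ (⁻¹-≢0 a≢0) (trans eq (solve 3 (λ c i b → c :* (i :* b) := i :* (c :* b)) refl c (a ⁻¹) (basisPoint j))))
      where
      c = proj₁ (emb-∼⇒ (a⁻¹bᵢ≢0 j) pᵢ∼pⱼ)
      c∈K = proj₁ (proj₂ (proj₂ (emb-∼⇒ (a⁻¹bᵢ≢0 j) pᵢ∼pⱼ)))
      eq = proj₂ (proj₂ (proj₂ (emb-∼⇒ (a⁻¹bᵢ≢0 j) pᵢ∼pⱼ)))
    exhaustive : ∀ P → P2q P → emb a I P → Σ[ i ∈ Fin (suc q) ] P ∼ point i
    exhaustive P (x , x≢0 , P∼) aIP = i , ∼-trans P∼ (≡scale⇒∼ (emb-NonZero x≢0) (trans (cong emb x≡c*a⁻¹bᵢ) (emb-scale _ c∈K)))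
      where
      Tr[ax]≡0 : Tr (a * x) ≡ 0#
      Tr[ax]≡0 = trans (sym (emb·emb≡Tr a x)) (I-respʳ-∼ (∼-sym P∼) aIP)
      i = proj₁ (basisPoint-surjective Tr[ax]≡0)
      c = proj₁ (proj₂ (basisPoint-surjective Tr[ax]≡0))
      c∈K = proj₁ (proj₂ (proj₂ (basisPoint-surjective Tr[ax]≡0)))
      ax≡cbᵢ = proj₂ (proj₂ (proj₂ (basisPoint-surjective Tr[ax]≡0)))
      x≡c*a⁻¹bᵢ : x ≡ c * (a ⁻¹ * basisPoint i)
      x≡c*a⁻¹bᵢ = begin
        x                          ≡⟨ ⁻¹-cancelˡ a≢0 x ⟨
        a ⁻¹ * (a * x)             ≡⟨ cong (a ⁻¹ *_) ax≡cbᵢ ⟩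
        a ⁻¹ * (c * basisPoint i)  ≡⟨ solve 3 (λ i c b → i :* (c :* b) := c :* (i :* b)) refl (a ⁻¹) c (basisPoint i) ⟩
        c * (a ⁻¹ * basisPoint i)  ∎

  reflect : Triple → Triple
  reflect (x , y , z) = (x , y , - z)

  reflect-involutive : ∀ P → reflect (reflect P) ≡ P
  reflect-involutive (x , y , z) = triple-≡ refl refl (-‿involutive z)

  reflect-∼ : ∀ {P Q} → P ∼ Q → reflect P ∼ reflect Q
  reflect-∼ {Q = x , y , z} (c , c≢0 , refl) = c , c≢0 , triple-≡ refl refl (-‿distribʳ-* c z)

  reflect-I : ∀ {ℓ P} → ℓ I P → reflect ℓ I reflect P
  reflect-I {a , b , c} {x , y , z} ℓIP = trans (solve 6 (λ a b c x y z → a :* x :+ b :* y :+ (:- c) :* (:- z) := a :* x :+ b :* y :+ c :* z) refl a b c x y z) ℓIP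

  reflect-NonZero : ∀ {P} → NonZero P → NonZero (reflect P)
  reflect-NonZero {P} P≢0 ρP≡0 = P≢0 (trans (sym (reflect-involutive P)) (trans (cong reflect ρP≡0) (triple-≡ refl refl -0#≈0#)))

  LineOf-reflect : ∀ {B B′ : TripleSet} → (∀ {P} → B′ P → B (reflect P)) → (∀ {P} → B (reflect P) → B′ P) →
                   ∀ {ℓ} → LineOf B′ ℓ → LineOf B (reflect ℓ)
  LineOf-reflect {B} to from {ℓ} (ℓ≢0 , f , f-on-ℓ , f-injective , exhaustive) =
    reflect-NonZero ℓ≢0 , reflect ∘ f , (λ i → to (proj₁ (f-on-ℓ i)) , reflect-I (proj₂ (f-on-ℓ i))) ,
    (λ i j ρfᵢ∼ρfⱼ → f-injective i j (subst₂ _∼_ (reflect-involutive (f i)) (reflect-involutive (f j)) (reflect-∼ ρfᵢ∼ρfⱼ))) ,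
    exhaustive′
    where
    exhaustive′ : ∀ P → B P → reflect ℓ I P → Σ[ i ∈ Fin (suc q) ] P ∼ reflect (f i)
    exhaustive′ P BP ρℓIP =
      let (i , ρP∼fᵢ) = exhaustive (reflect P) (from (subst B (sym (reflect-involutive P)) BP))
                                    (subst (_I reflect P) (reflect-involutive ℓ) (reflect-I ρℓIP))
      in i , subst (_∼ reflect (f i)) (reflect-involutive P) (reflect-∼ ρP∼fᵢ)

  -- Π_{-1} = {(r, r^q, -r^{q²})} is the image of P_{2,q} under reflect.
  Π-1-coordinates : ∀ r → (r * pow (- 1#) (q ℕ.+ 1) , fr r , fr2 r * - 1#) ≡ reflect (emb r)
  Π-1-coordinates r = triple-≡ (trans (cong (r *_) [-1]^[q+1]≡1) (*-identityʳ r)) refl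
                               (solve 1 (λ y → y :* (:- con 1ℤ) := :- y) refl (fr2 r))
    where
    [-1]^[q+1]≡1 : pow (- 1#) (q ℕ.+ 1) ≡ 1#
    [-1]^[q+1]≡1 = begin
      pow (- 1#) (q ℕ.+ 1)      ≡⟨ cong (pow (- 1#)) (ℕ.+-comm q 1) ⟩
      - 1# * fr (- 1#)          ≡⟨ cong (- 1# *_) (trans (Fr.-‿homo 1#) (cong -_ Fixed-1#)) ⟩
      - 1# * - 1#               ≡⟨ solve 0 ((:- con 1ℤ) :* (:- con 1ℤ) := con 1ℤ) refl ⟩
      1#                        ∎

  Π-1-point⇒ : ∀ {P} → Π (- 1#) P → Σ[ r ∈ Carrier ] r ≢ 0# × P ∼ reflect (emb r)
  Π-1-point⇒ (r , r≢0 , P∼) = r , r≢0 , subst (_ ∼_) (Π-1-coordinates r) P∼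

  Π-1-point⇐ : ∀ {P r} → r ≢ 0# → P ∼ reflect (emb r) → Π (- 1#) P
  Π-1-point⇐ {r = r} r≢0 P∼ = r , r≢0 , subst (_ ∼_) (sym (Π-1-coordinates r)) P∼

  Π-1⇒P2q : ∀ {P} → Π (- 1#) P → P2q (reflect P)
  Π-1⇒P2q {P} Π-P = let (r , r≢0 , P∼) = Π-1-point⇒ Π-P in r , r≢0 , subst (reflect P ∼_) (reflect-involutive (emb r)) (reflect-∼ P∼)

  P2q⇒Π-1 : ∀ {P} → P2q (reflect P) → Π (- 1#) P
  P2q⇒Π-1 {P} (r , r≢0 , ρP∼) = Π-1-point⇐ r≢0 (subst (_∼ reflect (emb r)) (reflect-involutive P) (reflect-∼ ρP∼))

  Π-1-line⇒ : ∀ {ℓ} → LineOf (Π (- 1#)) ℓ → Σ[ a ∈ Carrier ] a ≢ 0# × ℓ ∼ reflect (emb a)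
  Π-1-line⇒ {ℓ} ℓ-line =
    let (a , a≢0 , ρℓ∼) = P2q-line⇒ (LineOf-reflect Π-1⇒P2q P2q⇒Π-1 ℓ-line)
    in a , a≢0 , subst (_∼ reflect (emb a)) (reflect-involutive ℓ) (reflect-∼ ρℓ∼)

  Π-1-line : ∀ {a} → a ≢ 0# → LineOf (Π (- 1#)) (reflect (emb a))
  Π-1-line a≢0 = LineOf-reflect (λ {P} P2q-P → P2q⇒Π-1 (subst P2q (sym (reflect-involutive P)) P2q-P))
                                (λ {P} Π-ρP → subst P2q (reflect-involutive P) (Π-1⇒P2q Π-ρP))
                                (emb-line a≢0)

module Corollary {q} (F : FiniteField q) (q-prime-power : IsPrimePower q) where
  open LinesOfSubplanes F q-prime-power public
  open ≡-Reasoning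

  Pr-S1 : (B : TripleSet) →
          (∀ {P} → B P → Σ[ x ∈ Carrier ] x ≢ 0# × Σ[ z ∈ Carrier ] P ∼ (x , fr x , z)) →
          (∀ {x} → x ≢ 0# → Σ[ z ∈ Carrier ] B (x , fr x , z)) →
          S 1# ≐ Pr B
  Pr-S1 B B-points B-all R = S1⇒Pr , Pr⇒S1
    where
    S1⇒Pr : S 1# R → Pr B R
    S1⇒Pr (x , x≢0 , R∼) = ∼-NonZero R∼ (NonZero₂ (Fr.≢0 x≢0)) , I-respʳ-∼ R∼ mT-I ,
                           (x , fr x , z) , Bx , (fr x , - x , 0#) , NonZero₁ (Fr.≢0 x≢0) , I-T ,
                           ℓIx , I-respʳ-∼ R∼ (₁₂⇒I (trans (cong (λ y → fr x * y + - x * fr x) (*-identityʳ x)) ℓ·x≡0))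
      where
      z = proj₁ (B-all x≢0)
      Bx = proj₂ (B-all x≢0)
      ℓ·x≡0 : fr x * x + - x * fr x ≡ 0#
      ℓ·x≡0 = solve 2 (λ x X → X :* x :+ (:- x) :* X := con 0ℤ) refl x (fr x)
      ℓIx : (fr x , - x , 0#) I (x , fr x , z)
      ℓIx = trans (cong (fr x * x + - x * fr x +_) (zeroˡ z)) (trans (+-identityʳ _) ℓ·x≡0)
    Pr⇒S1 : Pr B R → S 1# R
    Pr⇒S1 (R≢0 , mTIR , P , BP , (l₁ , l₂ , l₃) , ℓ≢0 , ℓIT , ℓIP , ℓIR) = x , x≢0 , ∼-trans R∼ℓ∞ (∼-sym x∼ℓ∞)
      where
      x = proj₁ (B-points BP)
      x≢0 = proj₁ (proj₂ (B-points BP))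
      P∼ = proj₂ (proj₂ (proj₂ (B-points BP)))
      l₃≡0 = I-T⇒ ℓIT
      l₁≢0⊎l₂≢0 = NonZero⇒₁₂ ℓ≢0 l₃≡0
      R∼ℓ∞ : R ∼ (l₂ , - l₁ , 0#)
      R∼ℓ∞ = at-infinity l₁≢0⊎l₂≢0 (mT-I⇒ mTIR) R≢0 (I⇒₁₂ (inj₁ l₃≡0) ℓIR)
      x∼ℓ∞ : (x * 1# , fr x , 0#) ∼ (l₂ , - l₁ , 0#)
      x∼ℓ∞ = at-infinity l₁≢0⊎l₂≢0 refl (NonZero₁ (*-≢0 x≢0 1≢0))
               (subst (λ y → l₁ * y + l₂ * fr x ≡ 0#) (sym (*-identityʳ x)) (I⇒₁₂ (inj₁ l₃≡0) (I-respʳ-∼ (∼-sym P∼) ℓIP)))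

  Sp-S-1 : (B : TripleSet) →
           (∀ {ℓ} → LineOf B ℓ → Σ[ a ∈ Carrier ] a ≢ 0# × Σ[ c ∈ Carrier ] ℓ ∼ (a , fr a , c)) →
           (∀ {a} → a ≢ 0# → Σ[ c ∈ Carrier ] LineOf B (a , fr a , c)) →
           S (- 1#) ≐ Sp B
  Sp-S-1 B B-lines B-all R@(r₁ , r₂ , r₃) = S-1⇒Sp , Sp⇒S-1
    where
    S-1⇒Sp : S (- 1#) R → Sp B R
    S-1⇒Sp (x , x≢0 , R∼) = ∼-NonZero R∼ (NonZero₂ (Fr.≢0 x≢0)) , I-respʳ-∼ R∼ mT-I ,
                            (x ⁻¹ , fr (x ⁻¹) , c) , proj₂ (B-all (⁻¹-≢0 x≢0)) , ¬∼mT , I-respʳ-∼ R∼ (₁₂⇒I on-line)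
      where
      c = proj₁ (B-all (⁻¹-≢0 x≢0))
      ¬∼mT : ¬ (x ⁻¹ , fr (x ⁻¹) , c) ∼ mT
      ¬∼mT (d , _ , eq) = ⁻¹-≢0 x≢0 (trans (cong proj₁ eq) (zeroʳ d))
      on-line : x ⁻¹ * (x * - 1#) + fr (x ⁻¹) * fr x ≡ 0#
      on-line = begin
        x ⁻¹ * (x * - 1#) + fr (x ⁻¹) * fr x        ≡⟨ solve 4 (λ i x j X → i :* (x :* (:- con 1ℤ)) :+ j :* X := (:- (x :* i)) :+ X :* j) refl (x ⁻¹) x (fr (x ⁻¹)) (fr x) ⟩
        - (x * x ⁻¹) + fr x * fr (x ⁻¹)             ≡⟨ cong₂ (λ a b → - a + b) (⁻¹-inverseʳ x≢0) (Fr.*⁻¹-homo x≢0) ⟩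
        - 1# + 1#                                   ≡⟨ -‿inverseˡ 1# ⟩
        0#                                          ∎
    Sp⇒S-1 : Sp B R → S (- 1#) R
    Sp⇒S-1 (R≢0 , mTIR , ℓ , ℓ-line , _ , ℓIR) =
      S-resp-∼ (∼-trans R∼ (∼-reflexive (triple-≡ fr[-a]*-1 refl refl))) (S-intro (- 1#) (-‿≢0 a≢0))
      where
      a = proj₁ (B-lines ℓ-line)
      a≢0 = proj₁ (proj₂ (B-lines ℓ-line))
      ℓ∼ = proj₂ (proj₂ (proj₂ (B-lines ℓ-line)))
      R∼ : R ∼ (fr a , - a , 0#)
      R∼ = at-infinity (inj₁ a≢0) (mT-I⇒ mTIR) R≢0 (I⇒₁₂ (inj₂ (mT-I⇒ mTIR)) (I-respˡ-∼ (∼-sym ℓ∼) ℓIR))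
      fr[-a]*-1 : fr a ≡ fr (- a) * - 1#
      fr[-a]*-1 = trans (solve 1 (λ y → y := (:- y) :* (:- con 1ℤ)) refl (fr a)) (cong (_* - 1#) (sym (Fr.-‿homo a)))

  φ-reflect-emb : ∀ a → φ (reflect (emb a)) ≡ (- a , fr a , fr2 a)
  φ-reflect-emb a = triple-≡ (trans (Fr.-‿homo (fr2 a)) (cong -_ (fr∘fr2≡id a))) refl (fr∘fr≡fr2 a)

  φ²-reflect-emb : ∀ a → φ (φ (reflect (emb a))) ≡ (a , - fr a , fr2 a)
  φ²-reflect-emb a = trans (cong φ (φ-reflect-emb a)) (triple-≡ (fr∘fr2≡id a) (Fr.-‿homo a) (fr∘fr≡fr2 a))

  φ-φ²-reflect-emb-meet : ∀ a → φ (reflect (emb a)) I (fr a , a , 0#) × φ (φ (reflect (emb a))) I (fr a , a , 0#)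
  φ-φ²-reflect-emb-meet a =
    subst (_I (fr a , a , 0#)) (sym (φ-reflect-emb a)) (₁₂⇒I (solve 2 (λ a A → (:- a) :* A :+ A :* a := con 0ℤ) refl a (fr a))) ,
    subst (_I (fr a , a , 0#)) (sym (φ²-reflect-emb a)) (₁₂⇒I (solve 2 (λ a A → a :* A :+ (:- A) :* a := con 0ℤ) refl a (fr a)))

  φ-φ²-reflect-emb-meet⇒ : 1# + 1# ≢ 0# → ∀ {a R} → a ≢ 0# → NonZero R →
                           φ (reflect (emb a)) I R → φ (φ (reflect (emb a))) I R → R ∼ (fr a , a , 0#)
  φ-φ²-reflect-emb-meet⇒ 1+1≢0 {a} {r₁ , r₂ , r₃} a≢0 R≢0 φYIR φ²YIR =
    ∼-trans (at-infinity (inj₁ (-‿≢0 a≢0)) r₃≡0 R≢0 (I⇒₁₂ (inj₂ r₃≡0) e₁)) (∼-reflexive (triple-≡ refl (-‿involutive a) refl))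
    where
    e₁ : - a * r₁ + fr a * r₂ + fr2 a * r₃ ≡ 0#
    e₁ = subst (_I (r₁ , r₂ , r₃)) (φ-reflect-emb a) φYIR
    e₂ : a * r₁ + - fr a * r₂ + fr2 a * r₃ ≡ 0#
    e₂ = subst (_I (r₁ , r₂ , r₃)) (φ²-reflect-emb a) φ²YIR
    r₃≡0 : r₃ ≡ 0#
    r₃≡0 = x*y≡0⇒y≡0 (Fr2.≢0 a≢0) (x*y≡0⇒y≡0 1+1≢0 (begin
      (1# + 1#) * (fr2 a * r₃)         ≡⟨ solve 6 (λ a A B r₁ r₂ r₃ → (con 1ℤ :+ con 1ℤ) :* (B :* r₃) := ((:- a) :* r₁ :+ A :* r₂ :+ B :* r₃) :+ (a :* r₁ :+ (:- A) :* r₂ :+ B :* r₃)) refl a (fr a) (fr2 a) r₁ r₂ r₃ ⟩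
      (- a * r₁ + fr a * r₂ + fr2 a * r₃) + (a * r₁ + - fr a * r₂ + fr2 a * r₃) ≡⟨ cong₂ _+_ e₁ e₂ ⟩
      0# + 0#                          ≡⟨ +-identityʳ 0# ⟩
      0#                               ∎))

  S1≐μline : 1# + 1# ≢ 0# → S 1# ≐ μline (Π (- 1#))
  S1≐μline 1+1≢0 R = S1⇒μline , μline⇒S1
    where
    S1⇒μline : S 1# R → μline (Π (- 1#)) R
    S1⇒μline S1R = ∼-NonZero R∼ (NonZero₂ a≢0) , reflect (emb a) , Π-1-line a≢0 ,
                   I-respʳ-∼ R∼ (proj₁ (φ-φ²-reflect-emb-meet a)) , I-respʳ-∼ R∼ (proj₂ (φ-φ²-reflect-emb-meet a))
      where
      a = proj₁ (S-elim S1R)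
      a≢0 = proj₁ (proj₂ (S-elim S1R))
      R∼ : R ∼ (fr a , a , 0#)
      R∼ = ∼-trans (proj₂ (proj₂ (S-elim S1R))) (∼-reflexive (triple-≡ (*-identityʳ (fr a)) refl refl))
    μline⇒S1 : μline (Π (- 1#)) R → S 1# R
    μline⇒S1 (R≢0 , ℓ , ℓ-line , φℓIR , φ²ℓIR) =
      let (a , a≢0 , ℓ∼) = Π-1-line⇒ ℓ-line
          R∼ = φ-φ²-reflect-emb-meet⇒ 1+1≢0 a≢0 R≢0 (I-respˡ-∼ (φ-∼ (∼-sym ℓ∼)) φℓIR) (I-respˡ-∼ (φ-∼ (φ-∼ (∼-sym ℓ∼))) φ²ℓIR)
      in S-resp-∼ (∼-trans R∼ (∼-reflexive (triple-≡ (sym (*-identityʳ (fr a))) refl refl))) (S-intro 1# a≢0)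

  S-1≐Spμpt : 1# + 1# ≢ 0# → S (- 1#) ≐ SpL (μpt (Π (- 1#)))
  S-1≐Spμpt 1+1≢0 R@(r₁ , r₂ , r₃) = S-1⇒Spμpt , Spμpt⇒S-1
    where
    S-1⇒Spμpt : S (- 1#) R → SpL (μpt (Π (- 1#))) R
    S-1⇒Spμpt (x , x≢0 , R∼) = ∼-NonZero R∼ (NonZero₂ (Fr.≢0 x≢0)) , I-respʳ-∼ R∼ mT-I , ℓ , μpt-ℓ , ℓ≁mT , I-respʳ-∼ R∼ (₁₂⇒I ℓ·x≡0)
      where
      r = - x
      r≢0 = -‿≢0 x≢0
      ℓ = (fr r , r , 0#)
      μpt-ℓ : μpt (Π (- 1#)) ℓ
      μpt-ℓ = NonZero₂ r≢0 , reflect (emb r) , Π-1-point⇐ r≢0 ∼-refl ,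
              I-sym (proj₁ (φ-φ²-reflect-emb-meet r)) , I-sym (proj₂ (φ-φ²-reflect-emb-meet r))
      ℓ≁mT : ¬ ℓ ∼ mT
      ℓ≁mT (d , _ , ℓ≡dmT) = Fr.≢0 r≢0 (trans (cong proj₁ ℓ≡dmT) (zeroʳ d))
      ℓ·x≡0 : fr r * (x * - 1#) + r * fr x ≡ 0#
      ℓ·x≡0 = trans (cong (λ y → y * (x * - 1#) + r * fr x) (Fr.-‿homo x))
                    (solve 2 (λ x X → (:- X) :* (x :* (:- con 1ℤ)) :+ (:- x) :* X := con 0ℤ) refl x (fr x))
    Spμpt⇒S-1 : SpL (μpt (Π (- 1#))) R → S (- 1#) R
    Spμpt⇒S-1 (R≢0 , mTIR , ℓ , (ℓ≢0 , P , Π-P , ℓIφP , ℓIφ²P) , _ , ℓIR) =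
      - r , -‿≢0 r≢0 , ∼-trans R∼ (∼-reflexive (triple-≡ (solve 1 (λ r → r := (:- r) :* (:- con 1ℤ)) refl r) (sym (Fr.-‿homo r)) refl))
      where
      r = proj₁ (Π-1-point⇒ Π-P)
      r≢0 = proj₁ (proj₂ (Π-1-point⇒ Π-P))
      P∼ = proj₂ (proj₂ (Π-1-point⇒ Π-P))
      ℓ∼ : ℓ ∼ (fr r , r , 0#)
      ℓ∼ = φ-φ²-reflect-emb-meet⇒ 1+1≢0 r≢0 ℓ≢0 (I-respˡ-∼ (φ-∼ (∼-sym P∼)) (I-sym ℓIφP)) (I-respˡ-∼ (φ-∼ (φ-∼ (∼-sym P∼))) (I-sym ℓIφ²P))
      R∼ : R ∼ (r , - fr r , 0#)
      R∼ = at-infinity (inj₂ r≢0) (mT-I⇒ mTIR) R≢0 (I⇒₁₂ (inj₂ (mT-I⇒ mTIR)) (I-respˡ-∼ (∼-sym ℓ∼) ℓIR))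

  S1≐PrP2q : S 1# ≐ Pr P2q
  S1≐PrP2q = Pr-S1 P2q (λ (x , x≢0 , P∼) → x , x≢0 , fr2 x , P∼)
                       (λ {x} x≢0 → fr2 x , x , x≢0 , ∼-refl)

  S1≐PrΠ-1 : S 1# ≐ Pr (Π (- 1#))
  S1≐PrΠ-1 = Pr-S1 (Π (- 1#)) (λ Π-P → let (r , r≢0 , P∼) = Π-1-point⇒ Π-P in r , r≢0 , - fr2 r , P∼)
                              (λ {x} x≢0 → - fr2 x , Π-1-point⇐ x≢0 ∼-refl)

  S-1≐SpP2q : S (- 1#) ≐ Sp P2q
  S-1≐SpP2q = Sp-S-1 P2q (λ ℓ-line → let (a , a≢0 , ℓ∼) = P2q-line⇒ ℓ-line in a , a≢0 , fr2 a , ℓ∼)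
                         (λ {a} a≢0 → fr2 a , emb-line a≢0)

  S-1≐SpΠ-1 : S (- 1#) ≐ Sp (Π (- 1#))
  S-1≐SpΠ-1 = Sp-S-1 (Π (- 1#)) (λ ℓ-line → let (a , a≢0 , ℓ∼) = Π-1-line⇒ ℓ-line in a , a≢0 , - fr2 a , ℓ∼)
                                (λ {a} a≢0 → - fr2 a , Π-1-line a≢0)

  1³+1≡1+1 : 1# * 1# * 1# + 1# ≡ 1# + 1#
  1³+1≡1+1 = solve 0 (con 1ℤ :* con 1ℤ :* con 1ℤ :+ con 1ℤ := con 1ℤ :+ con 1ℤ) refl

  [-1]³+1≡0 : - 1# * - 1# * - 1# + 1# ≡ 0#
  [-1]³+1≡0 = solve 0 ((:- con 1ℤ) :* (:- con 1ℤ) :* (:- con 1ℤ) :+ con 1ℤ := con 0ℤ) refl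

  [-1]²≡1 : - 1# * - 1# ≡ 1#
  [-1]²≡1 = solve 0 ((:- con 1ℤ) :* (:- con 1ℤ) := con 1ℤ) refl

  S1-TypeIIPt : 1# + 1# ≡ 0# → ∀ P → S 1# P → TypeIIPt P
  S1-TypeIIPt 1+1≡0 = S-TypeIIPt Fixed-1# 1≢0 (trans 1³+1≡1+1 1+1≡0)

  S1-TypeIIIPt : 1# + 1# ≢ 0# → ∀ P → S 1# P → TypeIIIPt P
  S1-TypeIIIPt 1+1≢0 = S-TypeIIIPt Fixed-1# (1+1≢0 ∘ trans (sym 1³+1≡1+1))

  S-1-TypeIIPt : ∀ P → S (- 1#) P → TypeIIPt P
  S-1-TypeIIPt = S-TypeIIPt (Fixed-neg Fixed-1#) (-‿≢0 1≢0) [-1]³+1≡0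

  TS1-TypeIILine : ∀ ℓ → TS 1# ℓ → TypeIILine ℓ
  TS1-TypeIILine ℓ TS1ℓ = TypeIIPt⇒TypeIILine (S-1-TypeIIPt ℓ (TS⇒S Fixed-1# (*-identityˡ 1#) TS1ℓ))

  TS-1-TypeIIILine : 1# + 1# ≢ 0# → ∀ ℓ → TS (- 1#) ℓ → TypeIIILine ℓ
  TS-1-TypeIIILine 1+1≢0 ℓ TS-1ℓ =
    TypeIIIPt⇒TypeIIILine (S1-TypeIIIPt 1+1≢0 ℓ (subst (λ θ → S θ ℓ) (-‿involutive 1#) (TS⇒S (Fixed-neg Fixed-1#) [-1]²≡1 TS-1ℓ)))

  part1 : 1# + 1# ≡ 0# → Part1
  part1 1+1≡0 = S1-TypeIIPt 1+1≡0 , TS1-TypeIILine , S1≐PrP2q , subst (λ θ → S θ ≐ Sp P2q) -1≡1 S-1≐SpP2q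
    where
    -1≡1 : - 1# ≡ 1#
    -1≡1 = sym (x+y≡0⇒x≡-y 1+1≡0)

  part2a : 1# + 1# ≢ 0# → Part2a
  part2a 1+1≢0 = S1-TypeIIIPt 1+1≢0 , TS1-TypeIILine , S1≐μline 1+1≢0 , S1≐PrP2q , S1≐PrΠ-1

  part2b : 1# + 1# ≢ 0# → Part2b
  part2b 1+1≢0 = S-1-TypeIIPt , TS-1-TypeIIILine 1+1≢0 , S-1≐Spμpt 1+1≢0 , S-1≐SpP2q , S-1≐SpΠ-1

corollary5p2 : (q : ℕ) → IsPrimePower q → (F : FiniteField q) →
    ((2 ∣ q) → PG.Part1 F) × (¬ (2 ∣ q) → PG.Part2a F × PG.Part2b F)
corollary5p2 q q-prime-power F =
  (λ 2∣q → part1 (2∣q⇒1+1≡0 2∣q)) ,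
  (λ ¬2∣q → part2a (¬2∣q⇒1+1≢0 ¬2∣q) , part2b (¬2∣q⇒1+1≢0 ¬2∣q))
  where open Corollary F q-prime-power
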